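{- Let $N=n^2$ for a positive integer $n$, and let $G_N$ be the directed graph constructed below. Then: (i) for every Hamiltonian cycle $H$ of $G_N$ and every cell $(i,j)\in\{1,\dots,N\}^2$, there is exactly one $k\in\{1,\dots,N\}$ such that the arc $(x_{ijk1},v_{ij})$ lies on $H$, and writing the number $k$ in cell $(i,j)$ for every $(i,j)$ produces a valid $N\times N$ Sudoku solution (every row, every column and every block contains each of $1,\dots,N$ exactly once); (ii) conversely, every valid $N\times N$ Sudoku solution is obtained in this way from at least one Hamiltonian cycle of $G_N$. In particular, $G_N$ is Hamiltonian, and its Hamiltonian cycles correspond to valid Sudoku solutions.
   Context: A Sudoku grid of order $N=n^2$ is an $N\times N$ array of cells indexed by $(i,j)$ (row $i$, column $j$), each cell containing one of the numbers $1,\dots,N$. The grid is partitioned into $N$ blocks, each an $n\times n$ subarray of consecutive rows and columns; the blocks are numbered $1,\dots,N$ in a fixed order (e.g. row-major), and for a cell $(i,j)$, "the block $a$ containing $(i,j)$" refers to this numbering. A valid Sudoku solution is a grid in which every row, column and block contains each number $1,\dots,N$ exactly once. A Hamiltonian cycle of a directed graph is a directed cycle visiting every vertex exactly once. Construction of $G_N$. Throughout, $a,i,j,k$ range over $\{1,\dots,N\}$, and expressions $k+1$, $k+2$ in a number index are reduced modulo $N$ into $\{1,\dots,N\}$ (e.g. $N+1$ means $1$). Vertices: $s$, $f$; $b_{ak}$; $r_{ik}$; $t_i$; $c_{jk}$; $d_j$; $x_{ijkl}$ and $y_{ijkl}$ for $l=1,2,3$; $v_{ij}$; $w_{ij}$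 (total $6N^3+5N^2+2N+2$ vertices). Arcs: - $(s,b_{11})$, $(d_N,f)$, $(f,s)$; - $(b_{ak},x_{i,j,k+1,1})$ for all $a,k$ and all $(i,j)$ in block $a$; - $(x_{ijk1},x_{ijk2}),(x_{ijk2},x_{ijk1}),(x_{ijk2},x_{ijk3}),(x_{ijk3},x_{ijk2})$ for all $i,j,k$, and likewise with $y$ in place of $x$; - $(x_{ijk3},x_{i,j,k+1,1})$ and $(y_{ijk3},y_{i,j,k+1,1})$ for all $i,j,k$; - $(x_{ijk3},y_{i,j,k+2,1})$ for all $i,j,k$; - $(y_{ijk3},b_{a,k+2})$ for all $i,j$ and all $k\neq N-1$, where $a$ is the block containing $(i,j)$; - $(y_{i,j,N-1,3},b_{a+1,1})$ for all $(i,j)$ whose block $a$ satisfies $a<N$; - $(y_{i,j,N-1,3},r_{11})$ for all $(i,j)$ in block $N$; - $(r_{ik},x_{ijk3})$, $(x_{ijk1},v_{ij})$, $(v_{ij},r_{ik})$ for all $i,j,k$; $(v_{ij},t_i)$ for all $i,j$; $(t_i,r_{i+1,1})$ for $i<N$; $(t_N,c_{11})$; - $(c_{jk},y_{ijk3})$, $(y_{ijk1},w_{ij})$, $(w_{ij},c_{jk})$ for all $i,j,k$; $(w_{ij},d_j)$ for all $i,j$; $(d_j,c_{j+1,1})$ for $j<N$. -}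

module Defs where

open import Data.Nat using (ℕ; zero; suc; _+_; _*_; _/_; _<_; NonZero)
open import Data.Nat.Properties using (m*n≢0)
open import Data.Nat.DivMod using (_mod_)
open import Data.Fin using (Fin; toℕ)
open import Data.Product using (Σ; ∃; ∃-syntax; _×_)
open import Relation.Binary.PropositionalEquality using (_≡_; _≢_)
open import Function.Definitions using (Injective)

-- All indices are 0-based: the paper's index m ∈ {1,…,N} is represented by
-- the element of Fin N with toℕ = m - 1.  The layer index l ∈ {1,2,3} is Fin 3.

module Sudoku (n : ℕ) .{{_ : NonZero n}} where

  N : ℕ
  N = n * n

  instance
    nonZeroN : NonZero N
    nonZeroN = m*n≢0 n n

  _⊕_ : Fin N → ℕ → Fin N
  k ⊕ m = (toℕ k + m) mod N

  𝟎 : Fin N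
  𝟎 = 0 mod N

  block : Fin N → Fin N → Fin N
  block i j = ((toℕ i / n) * n + toℕ j / n) mod N

  Grid : Set
  Grid = Fin N → Fin N → Fin N

  ExactlyOne : {A : Set} → (A → Set) → Set
  ExactlyOne {A} P = Σ A λ a → P a × (∀ b → P b → b ≡ a)

  ValidSudoku : Grid → Set
  ValidSudoku g =
      (∀ i k → ExactlyOne λ j → g i j ≡ k)
    × (∀ j k → ExactlyOne λ i → g i j ≡ k)
    × (∀ a k → ExactlyOne {Fin N × Fin N}
                 λ { (i Data.Product., j) → block i j ≡ a × g i j ≡ k })

  data Vertex : Set where
    s f : Vertex
    b : Fin N → Fin N → Vertex
    r : Fin N → Fin N → Vertex
    t : Fin N → Vertex
    c : Fin N → Fin N → Vertex
    d : Fin N → Vertex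
    x y : Fin N → Fin N → Fin N → Fin 3 → Vertex
    v w : Fin N → Fin N → Vertex

  L1 L2 L3 : Fin 3
  L1 = Fin.zero
  L2 = Fin.suc Fin.zero
  L3 = Fin.suc (Fin.suc Fin.zero)

  data Arc : Vertex → Vertex → Set where
    s-b   : Arc s (b 𝟎 𝟎)
    d-f   : ∀ j → suc (toℕ j) ≡ N → Arc (d j) f
    f-s   : Arc f s
    b-x   : ∀ a k i j → block i j ≡ a → Arc (b a k) (x i j (k ⊕ 1) L1)
    x12   : ∀ i j k → Arc (x i j k L1) (x i j k L2)
    x21   : ∀ i j k → Arc (x i j k L2) (x i j k L1)
    x23   : ∀ i j k → Arc (x i j k L2) (x i j k L3)
    x32   : ∀ i j k → Arc (x i j k L3) (x i j k L2)
    y12   : ∀ i j k → Arc (y i j k L1) (y i j k L2)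
    y21   : ∀ i j k → Arc (y i j k L2) (y i j k L1)
    y23   : ∀ i j k → Arc (y i j k L2) (y i j k L3)
    y32   : ∀ i j k → Arc (y i j k L3) (y i j k L2)
    x-x   : ∀ i j k → Arc (x i j k L3) (x i j (k ⊕ 1) L1)
    y-y   : ∀ i j k → Arc (y i j k L3) (y i j (k ⊕ 1) L1)
    x-y   : ∀ i j k → Arc (x i j k L3) (y i j (k ⊕ 2) L1)
    -- k ≠ N-1 (1-based)  ⇔  toℕ k + 2 ≠ N (0-based)
    y-b   : ∀ i j k → toℕ k + 2 ≢ N → Arc (y i j k L3) (b (block i j) (k ⊕ 2))
    -- k = N-1 (1-based), block a < N, target block a+1
    y-b'  : ∀ i j k a' → toℕ k + 2 ≡ N → toℕ a' ≡ suc (toℕ (block i j))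
          → Arc (y i j k L3) (b a' 𝟎)
    -- k = N-1 (1-based), block a = N
    y-r   : ∀ i j k → toℕ k + 2 ≡ N → suc (toℕ (block i j)) ≡ N
          → Arc (y i j k L3) (r 𝟎 𝟎)
    r-x   : ∀ i j k → Arc (r i k) (x i j k L3)
    x-v   : ∀ i j k → Arc (x i j k L1) (v i j)
    v-r   : ∀ i j k → Arc (v i j) (r i k)
    v-t   : ∀ i j → Arc (v i j) (t i)
    t-r   : ∀ i i' → toℕ i' ≡ suc (toℕ i) → Arc (t i) (r i' 𝟎)
    t-c   : ∀ i → suc (toℕ i) ≡ N → Arc (t i) (c 𝟎 𝟎)
    c-y   : ∀ i j k → Arc (c j k) (y i j k L3)
    y-w   : ∀ i j k → Arc (y i j k L1) (w i j)
    w-c   : ∀ i j k → Arc (w i j) (c j k)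
    w-d   : ∀ i j → Arc (w i j) (d j)
    d-c   : ∀ j j' → toℕ j' ≡ suc (toℕ j) → Arc (d j) (c j' 𝟎)

  next : ∀ {m} → Fin (suc m) → Fin (suc m)
  next {m} p = suc (toℕ p) mod suc m

  record HamiltonianCycle : Set where
    field
      len       : ℕ
      seq       : Fin (suc len) → Vertex
      distinct  : Injective _≡_ _≡_ seq
      covering  : ∀ u → ∃[ p ] seq p ≡ u
      arcs      : ∀ p → Arc (seq p) (seq (next p))

  OnCycle : HamiltonianCycle → Vertex → Vertex → Set
  OnCycle H u u' = ∃[ p ] (seq p ≡ u × seq (next p) ≡ u')
    where open HamiltonianCycle H

  ReadsOff : HamiltonianCycle → Grid → Set
  ReadsOff H g = ∀ i j → OnCycle H (x i j (g i j) L1) (v i j)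
                       × (∀ k → OnCycle H (x i j k L1) (v i j) → k ≡ g i j)

module Submission where

-- A Hamiltonian cycle is described by its successor function succ. The middle vertex of a gadget
-- x i j k has only the neighbours x i j k 1 and x i j k 3, so the cycle either runs x₁ → x₂ → x₃
-- through it ("open"), or leaves x₁ for v i j, runs x₃ → x₂ → x₁ and is entered at x₃ from r i k
-- ("closed"). As v i j has one predecessor, exactly one gadget per cell is closed: its digit is the
-- grid. The successors of r i k and c j k give the row and column conditions; the y-gadgets are
-- forced to close at the same digits as the x-gadgets, and then the successors of the b a k give the
-- block condition. Conversely, from a valid grid the cycle is written down as a block phase, a row
-- phase and a column phase; it covers every vertex and is simple because a lexicographic rank
-- strictly increases along it. The classical pattern solution shows that a valid grid exists.

open import Data.Nat using (ℕ; zero; suc; _+_; _*_; _∸_; _≤_; _<_; _<?_; z≤n; s≤s; s≤s⁻¹; NonZero; _%_; _/_)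
open import Data.Nat.Properties
open import Data.Nat.DivMod
open import Data.Nat.Divisibility using (divides)
open import Algebra.Properties.CommutativeSemigroup +-commutativeSemigroup using (x∙yz≈y∙xz)
open import Data.Fin as Fin using (Fin; toℕ; fromℕ<; punchOut; combine; remQuot)
open import Data.Fin.Properties using (toℕ-injective; toℕ-fromℕ<; fromℕ<-toℕ; toℕ<n; injective⇒≤; punchOut-injective; any?; combine-injective; combine-remQuot; remQuot-combine; toℕ-combine)
open import Data.Product
open import Data.List using (List; []; _∷_; _++_; length; lookup)
import Data.List.Relation.Binary.Lex.Strict as Lex
open Lex using (this)
open import Data.List.Properties using (++-assoc; ++-identityʳ)
open import Data.Product.Properties using (×-≡,≡→≡; ,-injective)
open import Data.Empty using (⊥-elim)
open import Data.Sum using (_⊎_; inj₁; inj₂)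
open import Relation.Nullary using (yes; no)
open import Relation.Nullary.Decidable using (recompute)
open import Relation.Binary.PropositionalEquality
open import Relation.Binary.Bundles using (StrictPartialOrder)
open import Relation.Binary.Definitions using (tri<; tri≈; tri>)
open import Level using (0ℓ)
open import Function.Definitions using (Injective)
open import Function.Base using (case_of_; _∘_; id)
open import Defs using (module Sudoku)

[m%d+n]%d≡[m+n]%d : ∀ m n d .{{_ : NonZero d}} → (m % d + n) % d ≡ (m + n) % d
[m%d+n]%d≡[m+n]%d m n d = begin
  (m % d + n) % d         ≡⟨ %-distribˡ-+ (m % d) n d ⟩
  (m % d % d + n % d) % d ≡⟨ cong (λ z → (z + n % d) % d) (m%n%n≡m%n m d) ⟩
  (m % d + n % d) % d     ≡⟨ %-distribˡ-+ m n d ⟨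
  (m + n) % d             ∎
  where open ≡-Reasoning

+-cancelˡ-% : ∀ {a b c} d .{{_ : NonZero d}} → a ≤ d → b < d → c < d →
              (a + b) % d ≡ (a + c) % d → b ≡ c
+-cancelˡ-% {a} {b} {c} d a≤d b<d c<d eq =
  trans (sym (undo b<d)) (trans (cong (λ z → (z + (d ∸ a)) % d) eq) (undo c<d))
  where
  undo : ∀ {z} → z < d → ((a + z) % d + (d ∸ a)) % d ≡ z
  undo {z} z<d = begin
    ((a + z) % d + (d ∸ a)) % d ≡⟨ [m%d+n]%d≡[m+n]%d (a + z) (d ∸ a) d ⟩
    (a + z + (d ∸ a)) % d       ≡⟨ cong (_% d) (trans (cong (_+ (d ∸ a)) (+-comm a z)) (+-assoc z a (d ∸ a))) ⟩
    (z + (a + (d ∸ a))) % d     ≡⟨ cong (λ q → (z + q) % d) (m+[n∸m]≡n a≤d) ⟩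
    (z + d) % d                 ≡⟨ [m+n]%n≡m%n z d ⟩
    z % d                       ≡⟨ m<n⇒m%n≡m z<d ⟩
    z                           ∎
    where open ≡-Reasoning

m%n≡0⇒m≡n : ∀ {z} d .{{_ : NonZero d}} → 0 < z → z < d + d → z % d ≡ 0 → z ≡ d
m%n≡0⇒m≡n {z} d 0<z z<2d z%d≡0 with z <? d
... | yes z<d = ⊥-elim (<-irrefl (sym (trans (sym (m<n⇒m%n≡m z<d)) z%d≡0)) 0<z)
... | no z≮d = ≤-antisym (m∸n≡0⇒m≤n z∸d≡0) d≤z
  where
  d≤z : d ≤ z
  d≤z = ≮⇒≥ z≮d
  z∸d≡0 : z ∸ d ≡ 0
  z∸d≡0 = trans (sym (m<n⇒m%n≡m (subst (z ∸ d <_) (m+n∸m≡n d d) (∸-monoˡ-< z<2d d≤z))))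
                (trans (m≤n⇒[n∸m]%m≡n%m d≤z) z%d≡0)

injective⇒surjective : ∀ {m} {h : Fin m → Fin m} → Injective _≡_ _≡_ h → ∀ y → ∃ λ z → h z ≡ y
injective⇒surjective {zero} inj ()
injective⇒surjective {suc m} {h} inj y with any? (λ z → h z Fin.≟ y)
... | yes hit = hit
... | no miss = ⊥-elim (<-irrefl refl (injective⇒≤ squeezed-injective))
  where
  avoids : ∀ z → y ≢ h z
  avoids z eq = miss (z , sym eq)
  squeezed-injective : Injective _≡_ _≡_ (λ z → punchOut (avoids z))
  squeezed-injective eq = inj (punchOut-injective (avoids _) (avoids _) eq)

injective⇒surjective² : ∀ {m} {h : Fin m × Fin m → Fin m × Fin m} → Injective _≡_ _≡_ h →
                        ∀ y → ∃ λ z → h z ≡ y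
injective⇒surjective² {m} {h} inj (y₁ , y₂) with injective⇒surjective {h = h′} h′-injective (combine y₁ y₂)
  where
  h′ : Fin (m * m) → Fin (m * m)
  h′ z = uncurry combine (h (remQuot {m} m z))
  h′-injective : Injective _≡_ _≡_ h′
  h′-injective {z} {z′} eq = begin
    z                                  ≡⟨ combine-remQuot {m} m z ⟨
    uncurry combine (remQuot {m} m z)  ≡⟨ cong (uncurry combine) (inj (×-≡,≡→≡ (combine-injective _ _ _ _ eq))) ⟩
    uncurry combine (remQuot {m} m z′) ≡⟨ combine-remQuot {m} m z′ ⟩
    z′                                 ∎
    where open ≡-Reasoning
... | z , eq = remQuot {m} m z , ×-≡,≡→≡ (combine-injective _ _ _ _ eq)

Infix : {A : Set} → List A → List A → Set
Infix {A} M L = Σ (List A) λ P → Σ (List A) λ Q → L ≡ P ++ M ++ Q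

module _ {A : Set} where

  infix-refl : ∀ (L : List A) → Infix L L
  infix-refl L = [] , [] , sym (++-identityʳ L)

  infix-trans : ∀ {M L L′ : List A} → Infix M L → Infix L L′ → Infix M L′
  infix-trans {M} (P , Q , refl) (P′ , Q′ , refl) = P′ ++ P , Q ++ Q′ , (begin
    P′ ++ (P ++ M ++ Q) ++ Q′   ≡⟨ cong (P′ ++_) (++-assoc P (M ++ Q) Q′) ⟩
    P′ ++ P ++ (M ++ Q) ++ Q′   ≡⟨ cong (λ z → P′ ++ P ++ z) (++-assoc M Q Q′) ⟩
    P′ ++ P ++ M ++ Q ++ Q′     ≡⟨ ++-assoc P′ P (M ++ Q ++ Q′) ⟨
    (P′ ++ P) ++ M ++ Q ++ Q′   ∎)
    where open ≡-Reasoning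

  infix-++ˡ : ∀ {M} (L₁ L₂ : List A) → Infix M L₁ → Infix M (L₁ ++ L₂)
  infix-++ˡ L₁ L₂ M⊑L₁ = infix-trans M⊑L₁ ([] , L₂ , refl)

  infix-++ʳ : ∀ {M} (L₁ L₂ : List A) → Infix M L₂ → Infix M (L₁ ++ L₂)
  infix-++ʳ L₁ L₂ M⊑L₂ = infix-trans M⊑L₂ (L₁ , [] , cong (L₁ ++_) (sym (++-identityʳ L₂)))

  infix-∷ : ∀ {M} (u : A) L → Infix M L → Infix M (u ∷ L)
  infix-∷ u L = infix-++ʳ (u ∷ []) L

  lookupOr : A → List A → ℕ → A
  lookupOr d []      _       = d
  lookupOr d (u ∷ L) zero    = u
  lookupOr d (u ∷ L) (suc k) = lookupOr d L k

  lookupOr-lookup : ∀ d L (p : Fin (length L)) → lookupOr d L (toℕ p) ≡ lookup L p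
  lookupOr-lookup d (u ∷ L) Fin.zero    = refl
  lookupOr-lookup d (u ∷ L) (Fin.suc p) = lookupOr-lookup d L p

  lookupOr-length : ∀ d L → lookupOr d L (length L) ≡ d
  lookupOr-length d []      = refl
  lookupOr-length d (u ∷ L) = lookupOr-length d L

  infix-position : ∀ {u : A} {L} → Infix (u ∷ []) L → ∃ λ p → lookup L p ≡ u
  infix-position (P , Q , refl) = go P
    where
    go : ∀ {u Q} P → ∃ λ p → lookup (P ++ u ∷ Q) p ≡ u
    go []      = Fin.zero , refl
    go (_ ∷ P) = map Fin.suc id (go P)

  infix-position₂ : ∀ (d : A) {u u′ L} → Infix (u ∷ u′ ∷ []) L →
                    ∃ λ p → lookup L p ≡ u × lookupOr d L (suc (toℕ p)) ≡ u′
  infix-position₂ d (P , Q , refl) = go P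
    where
    go : ∀ {u u′ Q} P → ∃ λ p → lookup (P ++ u ∷ u′ ∷ Q) p ≡ u × lookupOr d (P ++ u ∷ u′ ∷ Q) (suc (toℕ p)) ≡ u′
    go []      = Fin.zero , refl , refl
    go (_ ∷ P) = map Fin.suc id (go P)

module RankedPaths {V : Set} (Arc : V → V → Set) (O : StrictPartialOrder 0ℓ 0ℓ 0ℓ)
                   (rank : V → StrictPartialOrder.Carrier O) where
  open StrictPartialOrder O public using (irrefl) renaming (_<_ to _≺_; trans to ≺-trans)
  open StrictPartialOrder.Eq O public using () renaming (refl to ≈-refl)

  Step : V → V → Set
  Step u u′ = Arc u u′ × rank u ≺ rank u′

  infixr 5 _∷_ _++ₚ_

  data Path : V → V → Set where
    []  : ∀ {u} → Path u u
    _∷_ : ∀ {u u′ w} → Step u u′ → Path u′ w → Path u w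

  vertices : ∀ {u w} → Path u w → List V
  vertices [] = []
  vertices (_∷_ {u} _ P) = u ∷ vertices P

  _++ₚ_ : ∀ {u u′ w} → Path u u′ → Path u′ w → Path u w
  [] ++ₚ Q      = Q
  (e ∷ P) ++ₚ Q = e ∷ (P ++ₚ Q)

  vertices-++ₚ : ∀ {u u′ w} (P : Path u u′) (Q : Path u′ w) → vertices (P ++ₚ Q) ≡ vertices P ++ vertices Q
  vertices-++ₚ [] Q = refl
  vertices-++ₚ (_∷_ {u} _ P) Q = cong (u ∷_) (vertices-++ₚ P Q)

  infix-++ₚˡ : ∀ {u u′ w M} (P : Path u u′) (Q : Path u′ w) → Infix M (vertices P) → Infix M (vertices (P ++ₚ Q))
  infix-++ₚˡ P Q M⊑P = subst (Infix _) (sym (vertices-++ₚ P Q)) (infix-++ˡ (vertices P) (vertices Q) M⊑P)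

  infix-++ₚʳ : ∀ {u u′ w M} (P : Path u u′) (Q : Path u′ w) → Infix M (vertices Q) → Infix M (vertices (P ++ₚ Q))
  infix-++ₚʳ P Q M⊑Q = subst (Infix _) (sym (vertices-++ₚ P Q)) (infix-++ʳ (vertices P) (vertices Q) M⊑Q)

  vertices-subst₂ : ∀ {u u′ w w′} (eu : u ≡ u′) (ew : w ≡ w′) (P : Path u w) → vertices (subst₂ Path eu ew P) ≡ vertices P
  vertices-subst₂ refl refl P = refl

  infix-subst₂ : ∀ {u u′ w w′ M} (eu : u ≡ u′) (ew : w ≡ w′) (P : Path u w) → Infix M (vertices P) → Infix M (vertices (subst₂ Path eu ew P))
  infix-subst₂ eu ew P = subst (Infix _) (sym (vertices-subst₂ eu ew P))

  concat : (W : ℕ → V) (m : ℕ) → (∀ k → .(k < m) → Path (W k) (W (suc k))) → Path (W 0) (W m)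
  concat W zero    piece = []
  concat W (suc m) piece = concat W m (λ k k<m → piece k (m≤n⇒m≤1+n k<m)) ++ₚ piece m (n<1+n m)

  infix-concat : ∀ W m (piece : ∀ k → .(k < m) → Path (W k) (W (suc k))) {M} k → (k<m : k < m) → Infix M (vertices (piece k k<m)) → Infix M (vertices (concat W m piece))
  infix-concat W (suc m) piece k k<1+m M⊑piece with k <? m
  ... | yes k<m = infix-++ₚˡ (concat W m _) (piece m _) (infix-concat W m (λ k k<m → piece k (m≤n⇒m≤1+n k<m)) k k<m M⊑piece)
  ... | no k≮m with ≤-antisym (s≤s⁻¹ k<1+m) (≮⇒≥ k≮m)
  ...   | refl = infix-++ₚʳ (concat W m _) (piece m _) M⊑piece

  path-arc : ∀ {u w} (P : Path u w) (q : Fin (length (vertices P))) →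
             Arc (lookup (vertices P) q) (lookupOr w (vertices P) (suc (toℕ q)))
  path-arc ((a , _) ∷ [])           Fin.zero    = a
  path-arc ((a , _) ∷ (e ∷ P))      Fin.zero    = a
  path-arc (_ ∷ P)                  (Fin.suc q) = path-arc P q

  lookupOr-start : ∀ {u w} (P : Path u w) → lookupOr w (vertices P) 0 ≡ u
  lookupOr-start []      = refl
  lookupOr-start (_ ∷ _) = refl

  rank-below-end : ∀ {u w} (P : Path u w) (q : Fin (length (vertices P))) → rank (lookup (vertices P) q) ≺ rank w
  rank-below-end ((_ , u≺) ∷ [])     Fin.zero    = u≺
  rank-below-end ((_ , u≺) ∷ (e ∷ P)) Fin.zero    = ≺-trans u≺ (rank-below-end (e ∷ P) Fin.zero)
  rank-below-end (_ ∷ P)             (Fin.suc q) = rank-below-end P q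

  rank-increasing : ∀ {u w} (P : Path u w) (p q : Fin (length (vertices P))) → toℕ p < toℕ q →
                    rank (lookup (vertices P) p) ≺ rank (lookup (vertices P) q)
  rank-increasing (e ∷ (_ ∷ _)) Fin.zero (Fin.suc Fin.zero)    _ = proj₂ e
  rank-increasing (e ∷ (e′ ∷ P)) Fin.zero (Fin.suc (Fin.suc q)) _ =
    ≺-trans (proj₂ e) (rank-increasing (e′ ∷ P) Fin.zero (Fin.suc q) (s≤s z≤n))
  rank-increasing (_ ∷ P) (Fin.suc p) (Fin.suc q) p<q = rank-increasing P p q (s≤s⁻¹ p<q)

  vertices-distinct : ∀ {u w} (P : Path u w) → Injective _≡_ _≡_ (lookup (vertices P))
  vertices-distinct P {p} {q} eq with <-cmp (toℕ p) (toℕ q)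
  ... | tri< p<q _ _ = ⊥-elim (irrefl ≈-refl (subst (λ z → rank (lookup (vertices P) p) ≺ rank z) (sym eq) (rank-increasing P p q p<q)))
  ... | tri≈ _ p≡q _ = toℕ-injective p≡q
  ... | tri> _ _ q<p = ⊥-elim (irrefl ≈-refl (subst (λ z → rank (lookup (vertices P) q) ≺ rank z) eq (rank-increasing P q p q<p)))

module _ (n : ℕ) .{{_ : NonZero n}} where
  open Sudoku n

  toℕ-next : ∀ {m} (p : Fin (suc m)) → toℕ (next p) ≡ suc (toℕ p) % suc m
  toℕ-next p = toℕ-fromℕ< _

  next-injective : ∀ {m} → Injective _≡_ _≡_ (next {m})
  next-injective {m} {p} {q} eq = toℕ-injective (+-cancelˡ-% (suc m) (s≤s z≤n) (toℕ<n p) (toℕ<n q)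
    (trans (sym (toℕ-next p)) (trans (cong toℕ eq) (toℕ-next q))))

  next∘next≢id : ∀ {m} → 2 ≤ m → (p : Fin (suc m)) → next (next p) ≢ p
  next∘next≢id {m} m≥2 p eq = case 2≡0 of λ ()
    where
    open ≡-Reasoning
    2≡0 : 2 ≡ 0
    2≡0 = +-cancelˡ-% (suc m) (<⇒≤ (toℕ<n p)) (s≤s m≥2) (s≤s z≤n) (begin
      (toℕ p + 2) % suc m              ≡⟨ cong (_% suc m) (+-comm (toℕ p) 2) ⟩
      (2 + toℕ p) % suc m              ≡⟨ cong (_% suc m) (+-comm (suc (toℕ p)) 1) ⟨
      (suc (toℕ p) + 1) % suc m        ≡⟨ [m%d+n]%d≡[m+n]%d (suc (toℕ p)) 1 (suc m) ⟨
      (suc (toℕ p) % suc m + 1) % suc m ≡⟨ cong (_% suc m) (+-comm _ 1) ⟩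
      suc (suc (toℕ p) % suc m) % suc m ≡⟨ cong (λ z → suc z % suc m) (toℕ-next p) ⟨
      suc (toℕ (next p)) % suc m       ≡⟨ toℕ-next (next p) ⟨
      toℕ (next (next p))              ≡⟨ cong toℕ eq ⟩
      toℕ p                            ≡⟨ m<n⇒m%n≡m (toℕ<n p) ⟨
      toℕ p % suc m                    ≡⟨ cong (_% suc m) (+-identityʳ (toℕ p)) ⟨
      (toℕ p + 0) % suc m              ∎)

  exactlyOne-preimage : ∀ {m} {h : Fin m → Fin m} → Injective _≡_ _≡_ h → ∀ k → ExactlyOne λ a → h a ≡ k
  exactlyOne-preimage inj k with injective⇒surjective inj k
  ... | a , ha≡k = a , ha≡k , λ a′ ha′≡k → inj (trans ha′≡k (sym ha≡k))

  split : Fin N → Fin n × Fin n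
  split = remQuot {n} n

  split-injective : Injective _≡_ _≡_ split
  split-injective {i} {i′} eq = trans (sym (combine-remQuot {n} n i)) (trans (cong (uncurry combine) eq) (combine-remQuot {n} n i′))

  _+ₙ_ : Fin n → Fin n → Fin n
  p +ₙ q = (toℕ p + toℕ q) mod n

  +ₙ-comm : ∀ p q → p +ₙ q ≡ q +ₙ p
  +ₙ-comm p q = cong (_mod n) (+-comm (toℕ p) (toℕ q))

  +ₙ-cancelˡ : ∀ p {q q′} → p +ₙ q ≡ p +ₙ q′ → q ≡ q′
  +ₙ-cancelˡ p {q} {q′} eq = toℕ-injective (+-cancelˡ-% n (<⇒≤ (toℕ<n p)) (toℕ<n q) (toℕ<n q′)
    (trans (sym (toℕ-fromℕ< _)) (trans (cong toℕ eq) (toℕ-fromℕ< _))))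

  +ₙ-cancelʳ : ∀ q {p p′} → p +ₙ q ≡ p′ +ₙ q → p ≡ p′
  +ₙ-cancelʳ q {p} {p′} eq = +ₙ-cancelˡ q (trans (+ₙ-comm q p) (trans eq (+ₙ-comm p′ q)))

  toℕ-combine/n : ∀ (p r₀ : Fin n) → toℕ (combine p r₀) / n ≡ toℕ p
  toℕ-combine/n p r₀ = begin
    toℕ (combine p r₀) / n     ≡⟨ cong (_/ n) (trans (toℕ-combine p r₀) (cong (_+ toℕ r₀) (*-comm n (toℕ p)))) ⟩
    (toℕ p * n + toℕ r₀) / n   ≡⟨ +-distrib-/-∣ˡ (toℕ r₀) (divides (toℕ p) refl) ⟩
    toℕ p * n / n + toℕ r₀ / n ≡⟨ cong₂ _+_ (m*n/n≡m (toℕ p) n) (m<n⇒m/n≡0 (toℕ<n r₀)) ⟩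
    toℕ p + 0                  ≡⟨ +-identityʳ (toℕ p) ⟩
    toℕ p                      ∎
    where open ≡-Reasoning

  block-combine : ∀ p r₀ q s₀ → block (combine p r₀) (combine q s₀) ≡ combine p q
  block-combine p r₀ q s₀ = toℕ-injective (begin
    toℕ (block (combine p r₀) (combine q s₀))                        ≡⟨ toℕ-fromℕ< _ ⟩
    ((toℕ (combine p r₀) / n) * n + toℕ (combine q s₀) / n) % N     ≡⟨ cong₂ (λ α β → (α * n + β) % N) (toℕ-combine/n p r₀) (toℕ-combine/n q s₀) ⟩
    (toℕ p * n + toℕ q) % N                                         ≡⟨ cong (_% N) (trans (cong (_+ toℕ q) (*-comm (toℕ p) n)) (sym (toℕ-combine p q))) ⟩
    toℕ (combine p q) % N                                           ≡⟨ m<n⇒m%n≡m (toℕ<n (combine p q)) ⟩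
    toℕ (combine p q)                                               ∎)
    where open ≡-Reasoning

  -- The classical pattern solution: writing i = n p + r₀ and j = n q + s₀, cell (i , j) holds
  -- n ((r₀ + q) mod n) + (p + s₀) mod n.
  patternValue : Fin n × Fin n → Fin n × Fin n → Fin N
  patternValue (p , r₀) (q , s₀) = combine (r₀ +ₙ q) (p +ₙ s₀)

  patternGrid : Grid
  patternGrid i j = patternValue (split i) (split j)

  patternGrid-rows : ∀ i → Injective _≡_ _≡_ (patternGrid i)
  patternGrid-rows i eq with combine-injective _ _ _ _ eq
  ... | q≡q′ , s₀≡s₀′ = split-injective (×-≡,≡→≡ (+ₙ-cancelˡ _ q≡q′ , +ₙ-cancelˡ _ s₀≡s₀′))

  patternGrid-columns : ∀ j → Injective _≡_ _≡_ (λ i → patternGrid i j)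
  patternGrid-columns j eq with combine-injective _ _ _ _ eq
  ... | r₀≡r₀′ , p≡p′ = split-injective (×-≡,≡→≡ (+ₙ-cancelʳ _ p≡p′ , +ₙ-cancelʳ _ r₀≡r₀′))

  module PatternBlock (a : Fin N) where
    cellAt : Fin N → Fin N × Fin N
    cellAt z = combine (proj₁ (split a)) (proj₁ (split z)) , combine (proj₂ (split a)) (proj₂ (split z))

    valueAt : Fin N → Fin N
    valueAt z = uncurry patternGrid (cellAt z)

    valueAt-injective : Injective _≡_ _≡_ valueAt
    valueAt-injective {z} {z′} eq with combine-injective _ _ _ _ (subst₂ _≡_ (value z) (value z′) eq)
      where
      value : ∀ z → valueAt z ≡ patternValue (proj₁ (split a) , proj₁ (split z)) (proj₂ (split a) , proj₂ (split z))
      value z = cong₂ patternValue (remQuot-combine {n} {n} _ _) (remQuot-combine {n} {n} _ _)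
    ... | r₀≡r₀′ , s₀≡s₀′ = split-injective (×-≡,≡→≡ (+ₙ-cancelʳ _ r₀≡r₀′ , +ₙ-cancelˡ _ s₀≡s₀′))

  block-split : ∀ i j → block i j ≡ combine (proj₁ (split i)) (proj₁ (split j))
  block-split i j = trans (cong₂ block (sym (combine-remQuot {n} n i)) (sym (combine-remQuot {n} n j))) (block-combine _ _ _ _)

  patternGrid-blocks : ∀ a k → ExactlyOne {Fin N × Fin N} λ (i , j) → block i j ≡ a × patternGrid i j ≡ k
  patternGrid-blocks a k with exactlyOne-preimage valueAt-injective k
    where open PatternBlock a
  ... | z , value-z , unique-z = cellAt z , (cellAt-block , value-z) , unique
    where
    open PatternBlock a
    cellAt-block : block (proj₁ (cellAt z)) (proj₂ (cellAt z)) ≡ a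
    cellAt-block = trans (block-combine _ _ _ _) (combine-remQuot {n} n a)
    unique : ∀ ((i , j) : Fin N × Fin N) → block i j ≡ a × patternGrid i j ≡ k → (i , j) ≡ cellAt z
    unique (i , j) (block≡a , value≡k) = trans (sym inBlock) (cong cellAt (unique-z _ (trans (cong (uncurry patternGrid) inBlock) value≡k)))
      where
      split-a : split a ≡ (proj₁ (split i) , proj₁ (split j))
      split-a = trans (cong split (trans (sym block≡a) (block-split i j))) (remQuot-combine {n} {n} _ _)
      inBlock : cellAt (combine (proj₂ (split i)) (proj₂ (split j))) ≡ (i , j)
      inBlock = trans (cong₂ (λ (p , q) (r₀ , s₀) → combine p r₀ , combine q s₀) split-a (remQuot-combine {n} {n} _ _))
                      (×-≡,≡→≡ (combine-remQuot {n} n i , combine-remQuot {n} n j))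

  patternGrid-valid : ValidSudoku patternGrid
  patternGrid-valid = (λ i → exactlyOne-preimage (patternGrid-rows i))
                    , (λ j → exactlyOne-preimage (patternGrid-columns j))
                    , patternGrid-blocks

module _ (n : ℕ) .{{_ : NonZero n}} (n≥2 : 2 ≤ n) where
  open Sudoku n

  N≥2 : 2 ≤ N
  N≥2 = ≤-trans n≥2 (m≤m*n n n)

  toℕ-⊕ : ∀ k m → toℕ (k ⊕ m) ≡ (toℕ k + m) % N
  toℕ-⊕ k m = toℕ-fromℕ< _

  ⊕-+ : ∀ k a e → (k ⊕ a) ⊕ e ≡ k ⊕ (a + e)
  ⊕-+ k a e = toℕ-injective (begin
    toℕ ((k ⊕ a) ⊕ e)        ≡⟨ toℕ-⊕ (k ⊕ a) e ⟩
    (toℕ (k ⊕ a) + e) % N    ≡⟨ cong (λ z → (z + e) % N) (toℕ-⊕ k a) ⟩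
    ((toℕ k + a) % N + e) % N ≡⟨ [m%d+n]%d≡[m+n]%d (toℕ k + a) e N ⟩
    (toℕ k + a + e) % N      ≡⟨ cong (_% N) (+-assoc (toℕ k) a e) ⟩
    (toℕ k + (a + e)) % N    ≡⟨ toℕ-⊕ k (a + e) ⟨
    toℕ (k ⊕ (a + e))        ∎)
    where open ≡-Reasoning

  ⊕-identityʳ : ∀ k → k ⊕ 0 ≡ k
  ⊕-identityʳ k = toℕ-injective (trans (toℕ-⊕ k 0) (trans (cong (_% N) (+-identityʳ (toℕ k))) (m<n⇒m%n≡m (toℕ<n k))))

  ⊕-N+ : ∀ k a → k ⊕ (N + a) ≡ k ⊕ a
  ⊕-N+ k a = toℕ-injective (begin
    toℕ (k ⊕ (N + a))      ≡⟨ toℕ-⊕ k (N + a) ⟩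
    (toℕ k + (N + a)) % N  ≡⟨ cong (_% N) (x∙yz≈y∙xz (toℕ k) N a) ⟩
    (N + (toℕ k + a)) % N  ≡⟨ cong (_% N) (+-comm N _) ⟩
    (toℕ k + a + N) % N    ≡⟨ [m+n]%n≡m%n (toℕ k + a) N ⟩
    (toℕ k + a) % N        ≡⟨ toℕ-⊕ k a ⟨
    toℕ (k ⊕ a)            ∎)
    where open ≡-Reasoning

  ⊕-cancelʳ : ∀ {a} → a ≤ N → ∀ {k k′} → k ⊕ a ≡ k′ ⊕ a → k ≡ k′
  ⊕-cancelʳ {a} a≤N {k} {k′} eq = toℕ-injective (+-cancelˡ-% N a≤N (toℕ<n k) (toℕ<n k′) (begin
    (a + toℕ k) % N   ≡⟨ cong (_% N) (+-comm a (toℕ k)) ⟩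
    (toℕ k + a) % N   ≡⟨ toℕ-⊕ k a ⟨
    toℕ (k ⊕ a)       ≡⟨ cong toℕ eq ⟩
    toℕ (k′ ⊕ a)      ≡⟨ toℕ-⊕ k′ a ⟩
    (toℕ k′ + a) % N  ≡⟨ cong (_% N) (+-comm (toℕ k′) a) ⟩
    (a + toℕ k′) % N  ∎))
    where open ≡-Reasoning

  ⊕1-cancelʳ : ∀ {k k′} → k ⊕ 1 ≡ k′ ⊕ 1 → k ≡ k′
  ⊕1-cancelʳ = ⊕-cancelʳ (<⇒≤ N≥2)

  ⊕-≢ : ∀ k {δ} → 0 < δ → δ < N → k ⊕ δ ≢ k
  ⊕-≢ k {δ} 0<δ δ<N eq = <-irrefl (sym δ≡0) 0<δ
    where
    open ≡-Reasoning
    δ≡0 : δ ≡ 0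
    δ≡0 = +-cancelˡ-% N (<⇒≤ (toℕ<n k)) δ<N (≤-trans 0<δ (<⇒≤ δ<N)) (begin
      (toℕ k + δ) % N  ≡⟨ toℕ-⊕ k δ ⟨
      toℕ (k ⊕ δ)      ≡⟨ cong toℕ eq ⟩
      toℕ k            ≡⟨ cong toℕ (⊕-identityʳ k) ⟨
      toℕ (k ⊕ 0)      ≡⟨ toℕ-⊕ k 0 ⟩
      (toℕ k + 0) % N  ∎)

  ⊕1-≢ : ∀ k → k ⊕ 1 ≢ k
  ⊕1-≢ k = ⊕-≢ k (s≤s z≤n) N≥2

  offset : Fin N → Fin N → ℕ
  offset k m = toℕ (m ⊕ (N ∸ toℕ k))

  offset-⊕ : ∀ k {δ} → δ < N → offset k (k ⊕ δ) ≡ δ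
  offset-⊕ k {δ} δ<N = begin
    toℕ ((k ⊕ δ) ⊕ (N ∸ toℕ k))      ≡⟨ cong toℕ (⊕-+ k δ (N ∸ toℕ k)) ⟩
    toℕ (k ⊕ (δ + (N ∸ toℕ k)))      ≡⟨ toℕ-⊕ k _ ⟩
    (toℕ k + (δ + (N ∸ toℕ k))) % N  ≡⟨ cong (_% N) (x∙yz≈y∙xz (toℕ k) δ (N ∸ toℕ k)) ⟩
    (δ + (toℕ k + (N ∸ toℕ k))) % N  ≡⟨ cong (λ z → (δ + z) % N) (m+[n∸m]≡n (<⇒≤ (toℕ<n k))) ⟩
    (δ + N) % N                      ≡⟨ [m+n]%n≡m%n δ N ⟩
    δ % N                            ≡⟨ m<n⇒m%n≡m δ<N ⟩
    δ                                ∎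
    where open ≡-Reasoning

  ⊕-offset : ∀ k m → k ⊕ offset k m ≡ m
  ⊕-offset k m = toℕ-injective (begin
    toℕ (k ⊕ offset k m)                     ≡⟨ toℕ-⊕ k _ ⟩
    (toℕ k + toℕ (m ⊕ (N ∸ toℕ k))) % N      ≡⟨ cong (λ z → (toℕ k + z) % N) (toℕ-⊕ m _) ⟩
    (toℕ k + (toℕ m + (N ∸ toℕ k)) % N) % N  ≡⟨ cong (_% N) (+-comm (toℕ k) _) ⟩
    ((toℕ m + (N ∸ toℕ k)) % N + toℕ k) % N  ≡⟨ [m%d+n]%d≡[m+n]%d _ (toℕ k) N ⟩
    (toℕ m + (N ∸ toℕ k) + toℕ k) % N        ≡⟨ cong (_% N) (trans (+-assoc (toℕ m) _ _) (cong (toℕ m +_) (m∸n+n≡m (<⇒≤ (toℕ<n k))))) ⟩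
    (toℕ m + N) % N                          ≡⟨ [m+n]%n≡m%n (toℕ m) N ⟩
    toℕ m % N                                ≡⟨ m<n⇒m%n≡m (toℕ<n m) ⟩
    toℕ m                                    ∎)
    where open ≡-Reasoning

  toℕ-𝟎 : toℕ 𝟎 ≡ 0
  toℕ-𝟎 = trans (toℕ-fromℕ< _) (m<n⇒m%n≡m (≤-trans (s≤s z≤n) N≥2))

  toℕ-⊕-< : ∀ k {δ} → toℕ k + δ < N → toℕ (k ⊕ δ) ≡ toℕ k + δ
  toℕ-⊕-< k k+δ<N = trans (toℕ-⊕ k _) (m<n⇒m%n≡m k+δ<N)

  ⊕1-toℕ : ∀ {K K′} → toℕ K′ ≡ suc (toℕ K) → K ⊕ 1 ≡ K′
  ⊕1-toℕ {K} {K′} eq = toℕ-injective (begin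
    toℕ (K ⊕ 1)   ≡⟨ toℕ-⊕-< K (subst (_< N) (trans eq (+-comm 1 (toℕ K))) (toℕ<n K′)) ⟩
    toℕ K + 1     ≡⟨ +-comm (toℕ K) 1 ⟩
    suc (toℕ K)   ≡⟨ eq ⟨
    toℕ K′        ∎)
    where open ≡-Reasoning

  toℕ-⊕1≡0 : ∀ k → suc (toℕ k) ≡ N → toℕ (k ⊕ 1) ≡ 0
  toℕ-⊕1≡0 k eq = trans (toℕ-⊕ k 1) (trans (cong (_% N) (trans (+-comm (toℕ k) 1) eq)) (n%n≡0 N))

  toℕ-⊕2≡0 : ∀ k → toℕ k + 2 ≡ N → toℕ (k ⊕ 2) ≡ 0
  toℕ-⊕2≡0 k eq = trans (toℕ-⊕ k 2) (trans (cong (_% N) eq) (n%n≡0 N))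

  toℕ+2≡N : ∀ k → toℕ (k ⊕ 2) ≡ 0 → toℕ k + 2 ≡ N
  toℕ+2≡N k eq = m%n≡0⇒m≡n N (≤-trans (s≤s z≤n) (m≤n+m 2 (toℕ k))) (+-mono-<-≤ (toℕ<n k) N≥2) (trans (sym (toℕ-⊕ k 2)) eq)

  ⊕-offset-suc : ∀ K m → m ≢ K → ∃ λ k → suc k < N × K ⊕ suc k ≡ m
  ⊕-offset-suc K m m≢K with offset K m in eq
  ... | zero  = ⊥-elim (m≢K (trans (sym (⊕-offset K m)) (trans (cong (K ⊕_) eq) (⊕-identityʳ K))))
  ... | suc k = k , subst (_< N) eq (toℕ<n (m ⊕ (N ∸ toℕ K))) , trans (cong (K ⊕_) (sym eq)) (⊕-offset K m)

  out-r : ∀ {i k u} → Arc (r i k) u → ∃ λ j → u ≡ x i j k L3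
  out-r (r-x i j k) = j , refl

  out-c : ∀ {j k u} → Arc (c j k) u → ∃ λ i → u ≡ y i j k L3
  out-c (c-y i j k) = i , refl

  out-b : ∀ {a k u} → Arc (b a k) u → ∃ λ ((i , j) : Fin N × Fin N) → u ≡ x i j (k ⊕ 1) L1
  out-b (b-x a k i j _) = (i , j) , refl

  in-v : ∀ {i j u} → Arc u (v i j) → ∃ λ k → u ≡ x i j k L1
  in-v (x-v i j k) = k , refl

  in-w : ∀ {i j u} → Arc u (w i j) → ∃ λ k → u ≡ y i j k L1
  in-w (y-w i j k) = k , refl

  out-x₁ : ∀ {i j k u} → Arc (x i j k L1) u → u ≡ x i j k L2 ⊎ u ≡ v i j
  out-x₁ (x12 i j k) = inj₁ refl
  out-x₁ (x-v i j k) = inj₂ refl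

  out-x₂ : ∀ {i j k u} → Arc (x i j k L2) u → u ≡ x i j k L1 ⊎ u ≡ x i j k L3
  out-x₂ (x21 i j k) = inj₁ refl
  out-x₂ (x23 i j k) = inj₂ refl

  out-x₃ : ∀ {i j k u} → Arc (x i j k L3) u →
           u ≡ x i j k L2 ⊎ u ≡ x i j (k ⊕ 1) L1 ⊎ u ≡ y i j (k ⊕ 2) L1
  out-x₃ (x32 i j k) = inj₁ refl
  out-x₃ (x-x i j k) = inj₂ (inj₁ refl)
  out-x₃ (x-y i j k) = inj₂ (inj₂ refl)

  in-x₁ : ∀ {i j k u} → Arc u (x i j k L1) →
          u ≡ x i j k L2
          ⊎ (∃ λ k′ → k′ ⊕ 1 ≡ k × u ≡ b (block i j) k′)
          ⊎ (∃ λ k′ → k′ ⊕ 1 ≡ k × u ≡ x i j k′ L3)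
  in-x₁ (x21 i j k) = inj₁ refl
  in-x₁ (b-x _ k i j refl) = inj₂ (inj₁ (k , refl , refl))
  in-x₁ (x-x i j k) = inj₂ (inj₂ (k , refl , refl))

  in-x₂ : ∀ {i j k u} → Arc u (x i j k L2) → u ≡ x i j k L1 ⊎ u ≡ x i j k L3
  in-x₂ (x12 i j k) = inj₁ refl
  in-x₂ (x32 i j k) = inj₂ refl

  in-x₃ : ∀ {i j k u} → Arc u (x i j k L3) → u ≡ x i j k L2 ⊎ u ≡ r i k
  in-x₃ (x23 i j k) = inj₁ refl
  in-x₃ (r-x i j k) = inj₂ refl

  out-y₁ : ∀ {i j k u} → Arc (y i j k L1) u → u ≡ y i j k L2 ⊎ u ≡ w i j
  out-y₁ (y12 i j k) = inj₁ refl
  out-y₁ (y-w i j k) = inj₂ refl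

  out-y₂ : ∀ {i j k u} → Arc (y i j k L2) u → u ≡ y i j k L1 ⊎ u ≡ y i j k L3
  out-y₂ (y21 i j k) = inj₁ refl
  out-y₂ (y23 i j k) = inj₂ refl

  in-y₁ : ∀ {i j k u} → Arc u (y i j k L1) →
          u ≡ y i j k L2
          ⊎ (∃ λ k′ → k′ ⊕ 1 ≡ k × u ≡ y i j k′ L3)
          ⊎ (∃ λ k′ → k′ ⊕ 2 ≡ k × u ≡ x i j k′ L3)
  in-y₁ (y21 i j k) = inj₁ refl
  in-y₁ (y-y i j k) = inj₂ (inj₁ (k , refl , refl))
  in-y₁ (x-y i j k) = inj₂ (inj₂ (k , refl , refl))

  in-y₂ : ∀ {i j k u} → Arc u (y i j k L2) → u ≡ y i j k L1 ⊎ u ≡ y i j k L3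
  in-y₂ (y12 i j k) = inj₁ refl
  in-y₂ (y32 i j k) = inj₂ refl

  in-y₃ : ∀ {i j k u} → Arc u (y i j k L3) → u ≡ y i j k L2 ⊎ u ≡ c j k
  in-y₃ (y23 i j k) = inj₁ refl
  in-y₃ (c-y i j k) = inj₂ refl

  x-injective : ∀ {i j k l i′ j′ k′ l′} → x i j k l ≡ x i′ j′ k′ l′ → i ≡ i′ × j ≡ j′ × k ≡ k′
  x-injective refl = refl , refl , refl

  y-injective : ∀ {i j k l i′ j′ k′ l′} → y i j k l ≡ y i′ j′ k′ l′ → i ≡ i′ × j ≡ j′ × k ≡ k′
  y-injective refl = refl , refl , refl

  module FromHamiltonianCycle (H : HamiltonianCycle) where
    open HamiltonianCycle H

    pos : Vertex → Fin (suc len)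
    pos u = proj₁ (covering u)

    seq-pos : ∀ u → seq (pos u) ≡ u
    seq-pos u = proj₂ (covering u)

    pos-seq : ∀ p → pos (seq p) ≡ p
    pos-seq p = distinct (seq-pos (seq p))

    len≥2 : 2 ≤ len
    len≥2 = s≤s⁻¹ (injective⇒≤ {f = pos ∘ three} (λ eq → three-injective (pos-injective eq)))
      where
      three : Fin 3 → Vertex
      three Fin.zero = s
      three (Fin.suc Fin.zero) = f
      three (Fin.suc (Fin.suc Fin.zero)) = t 𝟎
      three-injective : Injective _≡_ _≡_ three
      three-injective {Fin.zero} {Fin.zero} _ = refl
      three-injective {Fin.suc Fin.zero} {Fin.suc Fin.zero} _ = refl
      three-injective {Fin.suc (Fin.suc Fin.zero)} {Fin.suc (Fin.suc Fin.zero)} _ = refl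
      three-injective {Fin.zero} {Fin.suc Fin.zero} ()
      three-injective {Fin.zero} {Fin.suc (Fin.suc Fin.zero)} ()
      three-injective {Fin.suc Fin.zero} {Fin.zero} ()
      three-injective {Fin.suc Fin.zero} {Fin.suc (Fin.suc Fin.zero)} ()
      three-injective {Fin.suc (Fin.suc Fin.zero)} {Fin.zero} ()
      three-injective {Fin.suc (Fin.suc Fin.zero)} {Fin.suc Fin.zero} ()
      pos-injective : ∀ {u u′} → pos u ≡ pos u′ → u ≡ u′
      pos-injective {u} {u′} eq = trans (sym (seq-pos u)) (trans (cong seq eq) (seq-pos u′))

    opaque
      succ : Vertex → Vertex
      succ u = seq (next (pos u))

      succ-arc : ∀ u → Arc u (succ u)
      succ-arc u = subst (λ z → Arc z (succ u)) (seq-pos u) (arcs (pos u))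

      succ-injective : ∀ {u u′} → succ u ≡ succ u′ → u ≡ u′
      succ-injective {u} {u′} eq =
        trans (sym (seq-pos u)) (trans (cong seq (next-injective n (distinct eq))) (seq-pos u′))

      succ²≢id : ∀ u → succ (succ u) ≢ u
      succ²≢id u eq = next∘next≢id n len≥2 (pos u) (distinct (begin
        seq (next (next (pos u)))        ≡⟨ cong (λ q → seq (next q)) (pos-seq (next (pos u))) ⟨
        succ (succ u)                    ≡⟨ eq ⟩
        u                                ≡⟨ seq-pos u ⟨
        seq (pos u)                      ∎))
        where open ≡-Reasoning

      predecessor : ∀ u {P : Vertex → Set} → (∀ {w} → Arc w u → P w) → ∃ λ w → P w × succ w ≡ u
      predecessor u classify with injective⇒surjective (next-injective n) (pos u)
      ... | p , next-p = seq p , classify (subst (Arc (seq p)) seq-next-p (arcs p)) , (begin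
        seq (next (pos (seq p)))  ≡⟨ cong (λ q → seq (next q)) (pos-seq p) ⟩
        seq (next p)              ≡⟨ seq-next-p ⟩
        u                         ∎)
        where
        open ≡-Reasoning
        seq-next-p : seq (next p) ≡ u
        seq-next-p = trans (cong seq next-p) (seq-pos u)

      onCycle-succ : ∀ u → OnCycle H u (succ u)
      onCycle-succ u = pos u , seq-pos u , refl

      onCycle⇒succ : ∀ {u u′} → OnCycle H u u′ → succ u ≡ u′
      onCycle⇒succ (p , refl , next→u′) = trans (cong (λ q → seq (next q)) (pos-seq p)) next→u′

    x-closed : ∀ {i j k} → succ (x i j k L1) ≡ v i j →
               succ (x i j k L3) ≡ x i j k L2 × succ (r i k) ≡ x i j k L3
    x-closed {i} {j} {k} x₁→v with predecessor (x i j k L2) in-x₂ | predecessor (x i j k L3) in-x₃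
    ... | _ , inj₁ refl , x₁→x₂ | _ = case trans (sym x₁→v) x₁→x₂ of λ ()
    ... | _ , inj₂ refl , x₃→x₂ | _ , inj₁ refl , x₂→x₃ = ⊥-elim (succ²≢id (x i j k L3) (trans (cong succ x₃→x₂) x₂→x₃))
    ... | _ , inj₂ refl , x₃→x₂ | _ , inj₂ refl , r→x₃ = x₃→x₂ , r→x₃

    r-closes-x : ∀ {i j k} → succ (r i k) ≡ x i j k L3 → succ (x i j k L1) ≡ v i j
    r-closes-x {i} {j} {k} r→x₃ with out-x₂ (succ-arc (x i j k L2)) | out-x₁ (succ-arc (x i j k L1))
    ... | inj₂ x₂→x₃ | _ = case succ-injective {x i j k L2} {r i k} (trans x₂→x₃ (sym r→x₃)) of λ ()
    ... | inj₁ x₂→x₁ | inj₁ x₁→x₂ = ⊥-elim (succ²≢id (x i j k L1) (trans (cong succ x₁→x₂) x₂→x₁))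
    ... | inj₁ _     | inj₂ x₁→v = x₁→v

    module OpenX {i j k} (x₁↛v : succ (x i j k L1) ≢ v i j) where
      x₁→x₂ : succ (x i j k L1) ≡ x i j k L2
      x₁→x₂ with out-x₁ (succ-arc (x i j k L1))
      ... | inj₁ eq = eq
      ... | inj₂ eq = ⊥-elim (x₁↛v eq)

      x₂→x₃ : succ (x i j k L2) ≡ x i j k L3
      x₂→x₃ with out-x₂ (succ-arc (x i j k L2))
      ... | inj₁ eq = ⊥-elim (succ²≢id (x i j k L1) (trans (cong succ x₁→x₂) eq))
      ... | inj₂ eq = eq

      x₃-exit : succ (x i j k L3) ≡ x i j (k ⊕ 1) L1 ⊎ succ (x i j k L3) ≡ y i j (k ⊕ 2) L1
      x₃-exit with out-x₃ (succ-arc (x i j k L3))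
      ... | inj₁ eq = ⊥-elim (succ²≢id (x i j k L2) (trans (cong succ x₂→x₃) eq))
      ... | inj₂ eq = eq

      x₁-entry : (∃ λ k′ → k′ ⊕ 1 ≡ k × succ (b (block i j) k′) ≡ x i j k L1)
               ⊎ (∃ λ k′ → k′ ⊕ 1 ≡ k × succ (x i j k′ L3) ≡ x i j k L1)
      x₁-entry with predecessor (x i j k L1) in-x₁
      ... | _ , inj₁ refl , x₂→x₁ = case trans (sym x₂→x₃) x₂→x₁ of λ ()
      ... | _ , inj₂ (inj₁ (k′ , k′⊕1≡k , refl)) , b→x₁ = inj₁ (k′ , k′⊕1≡k , b→x₁)
      ... | _ , inj₂ (inj₂ (k′ , k′⊕1≡k , refl)) , x₃→x₁ = inj₂ (k′ , k′⊕1≡k , x₃→x₁)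

    y-closed : ∀ {i j k} → succ (y i j k L1) ≡ w i j →
               succ (y i j k L3) ≡ y i j k L2 × succ (c j k) ≡ y i j k L3
    y-closed {i} {j} {k} y₁→w with predecessor (y i j k L2) in-y₂ | predecessor (y i j k L3) in-y₃
    ... | _ , inj₁ refl , y₁→y₂ | _ = case trans (sym y₁→w) y₁→y₂ of λ ()
    ... | _ , inj₂ refl , y₃→y₂ | _ , inj₁ refl , y₂→y₃ = ⊥-elim (succ²≢id (y i j k L3) (trans (cong succ y₃→y₂) y₂→y₃))
    ... | _ , inj₂ refl , y₃→y₂ | _ , inj₂ refl , c→y₃ = y₃→y₂ , c→y₃

    c-closes-y : ∀ {i j k} → succ (c j k) ≡ y i j k L3 → succ (y i j k L1) ≡ w i j
    c-closes-y {i} {j} {k} c→y₃ with out-y₂ (succ-arc (y i j k L2)) | out-y₁ (succ-arc (y i j k L1))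
    ... | inj₂ y₂→y₃ | _ = case succ-injective {y i j k L2} {c j k} (trans y₂→y₃ (sym c→y₃)) of λ ()
    ... | inj₁ y₂→y₁ | inj₁ y₁→y₂ = ⊥-elim (succ²≢id (y i j k L1) (trans (cong succ y₁→y₂) y₂→y₁))
    ... | inj₁ _     | inj₂ y₁→w = y₁→w

    y₁-entry : ∀ {i j k} → succ (y i j k L1) ≢ w i j →
               (∃ λ k′ → k′ ⊕ 1 ≡ k × succ (y i j k′ L3) ≡ y i j k L1)
             ⊎ (∃ λ k′ → k′ ⊕ 2 ≡ k × succ (x i j k′ L3) ≡ y i j k L1)
    y₁-entry {i} {j} {k} y₁↛w with predecessor (y i j k L1) in-y₁ | out-y₁ (succ-arc (y i j k L1))
    ... | _ , inj₂ (inj₁ (k′ , k′⊕1≡k , refl)) , y₃→y₁ | _ = inj₁ (k′ , k′⊕1≡k , y₃→y₁)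
    ... | _ , inj₂ (inj₂ (k′ , k′⊕2≡k , refl)) , x₃→y₁ | _ = inj₂ (k′ , k′⊕2≡k , x₃→y₁)
    ... | _ , inj₁ refl , y₂→y₁ | inj₁ y₁→y₂ = ⊥-elim (succ²≢id (y i j k L1) (trans (cong succ y₁→y₂) y₂→y₁))
    ... | _ , inj₁ refl , _     | inj₂ y₁→w = ⊥-elim (y₁↛w y₁→w)

    v-entry : ∀ i j → ∃ λ k → succ (x i j k L1) ≡ v i j
    v-entry i j with predecessor (v i j) in-v
    ... | _ , (k , refl) , x₁→v = k , x₁→v

    grid : Grid
    grid i j = proj₁ (v-entry i j)

    x-grid-closed : ∀ {i j} → succ (x i j (grid i j) L1) ≡ v i j
    x-grid-closed {i} {j} = proj₂ (v-entry i j)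

    grid-unique : ∀ {i j k} → succ (x i j k L1) ≡ v i j → k ≡ grid i j
    grid-unique {i} {j} {k} eq = proj₂ (proj₂ (x-injective (succ-injective {x i j k L1} {x i j (grid i j) L1} (trans eq (sym x-grid-closed)))))

    w-entry : ∀ i j → ∃ λ k → succ (y i j k L1) ≡ w i j
    w-entry i j with predecessor (w i j) in-w
    ... | _ , (k , refl) , y₁→w = k , y₁→w

    gridʸ : Grid
    gridʸ i j = proj₁ (w-entry i j)

    y-gridʸ-closed : ∀ {i j} → succ (y i j (gridʸ i j) L1) ≡ w i j
    y-gridʸ-closed {i} {j} = proj₂ (w-entry i j)

    gridʸ-unique : ∀ {i j k} → succ (y i j k L1) ≡ w i j → k ≡ gridʸ i j
    gridʸ-unique {i} {j} {k} eq = proj₂ (proj₂ (y-injective (succ-injective {y i j k L1} {y i j (gridʸ i j) L1} (trans eq (sym y-gridʸ-closed)))))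

    x-open : ∀ {i j k} → k ≢ grid i j → succ (x i j k L1) ≢ v i j
    x-open k≢g x₁→v = k≢g (grid-unique x₁→v)

    x₃-grid : ∀ {i j} → succ (x i j (grid i j) L3) ≡ x i j (grid i j) L2
    x₃-grid = proj₁ (x-closed x-grid-closed)

    succ-b-grid : ∀ i j → succ (b (block i j) (grid i j)) ≡ x i j (grid i j ⊕ 1) L1
    succ-b-grid i j with OpenX.x₁-entry (x-open {i} {j} (λ eq → ⊕1-≢ (grid i j) eq))
    ... | inj₁ (k′ , k′⊕1≡ , eq) = subst (λ z → succ (b (block i j) z) ≡ _) (⊕1-cancelʳ k′⊕1≡) eq
    ... | inj₂ (k′ , k′⊕1≡ , eq) with ⊕1-cancelʳ k′⊕1≡
    ...   | refl = case trans (sym eq) x₃-grid of λ ()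

    b-exit : ∀ a k → ∃ λ ((i , j) : Fin N × Fin N) → succ (b a k) ≡ x i j (k ⊕ 1) L1
    b-exit a k = out-b (succ-arc (b a k))

    cellOf : Fin N × Fin N → Fin N × Fin N
    cellOf (a , k) = proj₁ (b-exit a k)

    blockAndDigit : Fin N × Fin N → Fin N × Fin N
    blockAndDigit (i , j) = block i j , grid i j

    cellOf-unique : ∀ {a k i j m} → succ (b a k) ≡ x i j m L1 → cellOf (a , k) ≡ (i , j)
    cellOf-unique {a} {k} eq with x-injective (trans (sym (proj₂ (b-exit a k))) eq)
    ... | refl , refl , _ = refl

    cellOf∘blockAndDigit : ∀ ij → cellOf (blockAndDigit ij) ≡ ij
    cellOf∘blockAndDigit (i , j) = cellOf-unique (succ-b-grid i j)

    blockAndDigit-injective : Injective _≡_ _≡_ blockAndDigit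
    blockAndDigit-injective {p} {q} eq =
      trans (sym (cellOf∘blockAndDigit p)) (trans (cong cellOf eq) (cellOf∘blockAndDigit q))

    blockAndDigit∘cellOf : ∀ ak → blockAndDigit (cellOf ak) ≡ ak
    blockAndDigit∘cellOf ak = begin
      blockAndDigit (cellOf ak)                   ≡⟨ cong (blockAndDigit ∘ cellOf) (proj₂ hit) ⟨
      blockAndDigit (cellOf (blockAndDigit ij))   ≡⟨ cong blockAndDigit (cellOf∘blockAndDigit ij) ⟩
      blockAndDigit ij                            ≡⟨ proj₂ hit ⟩
      ak                                          ∎
      where
      open ≡-Reasoning
      hit : ∃ λ ij → blockAndDigit ij ≡ ak
      hit = injective⇒surjective² blockAndDigit-injective ak
      ij : Fin N × Fin N
      ij = proj₁ hit

    succ-b-unique : ∀ {a k i j m} → succ (b a k) ≡ x i j m L1 → a ≡ block i j × k ≡ grid i j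
    succ-b-unique {a} {k} eq =
      ,-injective (trans (sym (blockAndDigit∘cellOf (a , k))) (cong blockAndDigit (cellOf-unique eq)))

    x-passes : ∀ {i j k} → k ≢ grid i j → k ⊕ 1 ≢ grid i j → succ (x i j k L3) ≡ x i j (k ⊕ 1) L1
    x-passes {i} {j} {k} k≢g k⊕1≢g with OpenX.x₃-exit (x-open k≢g)
    ... | inj₁ eq = eq
    ... | inj₂ x₃→y with OpenX.x₁-entry (x-open {i} {j} k⊕1≢g)
    ...   | inj₁ (k′ , k′⊕1≡ , eq) = ⊥-elim (k≢g (trans (sym (⊕1-cancelʳ k′⊕1≡)) (proj₂ (succ-b-unique eq))))
    ...   | inj₂ (k′ , k′⊕1≡ , eq) with ⊕1-cancelʳ k′⊕1≡
    ...     | refl = case trans (sym x₃→y) eq of λ ()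

    -- The y-gadget left open at gridʸ ⊕ 1 must be entered from an x-gadget, which forces gridʸ ≡ grid.
    gridʸ≡grid : ∀ i j → gridʸ i j ≡ grid i j
    gridʸ≡grid i j with y₁-entry {i} {j} (λ eq → ⊕1-≢ (gridʸ i j) (gridʸ-unique eq))
    ... | inj₁ (k′ , k′⊕1≡ , eq) with ⊕1-cancelʳ k′⊕1≡
    ...   | refl = case trans (sym eq) (proj₁ (y-closed y-gridʸ-closed)) of λ ()
    gridʸ≡grid i j | inj₂ (k′ , k′⊕2≡ , eq) with k′ Fin.≟ grid i j | k′ ⊕ 1 Fin.≟ grid i j
    ... | yes refl | _ = case trans (sym eq) x₃-grid of λ ()
    ... | no k′≢g | no k′⊕1≢g = case trans (sym eq) (x-passes k′≢g k′⊕1≢g) of λ ()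
    ... | no _ | yes k′⊕1≡g = ⊕1-cancelʳ (begin
      gridʸ i j ⊕ 1  ≡⟨ k′⊕2≡ ⟨
      k′ ⊕ 2         ≡⟨ ⊕-+ k′ 1 1 ⟨
      (k′ ⊕ 1) ⊕ 1   ≡⟨ cong (_⊕ 1) k′⊕1≡g ⟩
      grid i j ⊕ 1   ∎)
      where open ≡-Reasoning

    rows-valid : ∀ i k → ExactlyOne λ j → grid i j ≡ k
    rows-valid i k with out-r (succ-arc (r i k))
    ... | j , r→x₃ = j , sym (grid-unique (r-closes-x r→x₃)) , unique
      where
      unique : ∀ j′ → grid i j′ ≡ k → j′ ≡ j
      unique j′ g≡k = proj₁ (proj₂ (x-injective (trans (sym r→x₃′) r→x₃)))
        where
        r→x₃′ : succ (r i k) ≡ x i j′ k L3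
        r→x₃′ = proj₂ (x-closed (subst (λ z → succ (x i j′ z L1) ≡ v i j′) g≡k x-grid-closed))

    columns-valid : ∀ j k → ExactlyOne λ i → grid i j ≡ k
    columns-valid j k with out-c (succ-arc (c j k))
    ... | i , c→y₃ = i , trans (sym (gridʸ≡grid i j)) (sym (gridʸ-unique (c-closes-y c→y₃))) , unique
      where
      unique : ∀ i′ → grid i′ j ≡ k → i′ ≡ i
      unique i′ g≡k = proj₁ (y-injective (trans (sym c→y₃′) c→y₃))
        where
        c→y₃′ : succ (c j k) ≡ y i′ j k L3
        c→y₃′ = proj₂ (y-closed (subst (λ z → succ (y i′ j z L1) ≡ w i′ j) (trans (gridʸ≡grid i′ j) g≡k) y-gridʸ-closed))

    blocks-valid : ∀ a k → ExactlyOne {Fin N × Fin N} λ (i , j) → block i j ≡ a × grid i j ≡ k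
    blocks-valid a k = cellOf (a , k) , ,-injective (blockAndDigit∘cellOf (a , k)) , unique
      where
      unique : ∀ ij → block (proj₁ ij) (proj₂ ij) ≡ a × grid (proj₁ ij) (proj₂ ij) ≡ k → ij ≡ cellOf (a , k)
      unique ij (refl , refl) = sym (cellOf∘blockAndDigit ij)

    grid-valid : ValidSudoku grid
    grid-valid = rows-valid , columns-valid , blocks-valid

    reads-grid : ReadsOff H grid
    reads-grid i j = subst (OnCycle H _) x-grid-closed (onCycle-succ _) , λ k x₁→v → grid-unique (onCycle⇒succ x₁→v)

  pattern same R≺R′ = Lex.next refl R≺R′

  lexicographic : StrictPartialOrder 0ℓ 0ℓ 0ℓ
  lexicographic = Lex.<-strictPartialOrder <-strictPartialOrder

  module ClosingPath (rank : Vertex → List ℕ)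
                     (P : RankedPaths.Path Arc lexicographic rank s f)
                     (covers : ∀ u → u ≡ f ⊎ Infix (u ∷ []) (RankedPaths.vertices Arc lexicographic rank P)) where
    open RankedPaths Arc lexicographic rank

    L : List Vertex
    L = vertices P

    order : Fin (suc (length L)) → Vertex
    order = lookup (f ∷ L)

    order-next : ∀ p → order (next p) ≡ lookupOr f L (toℕ p)
    order-next p with m≤n⇒m<n∨m≡n (s≤s⁻¹ (toℕ<n p))
    ... | inj₁ p<len = begin
      order (next p)                     ≡⟨ lookupOr-lookup f (f ∷ L) (next p) ⟨
      lookupOr f (f ∷ L) (toℕ (next p))  ≡⟨ cong (lookupOr f (f ∷ L)) (trans (toℕ-next n p) (m<n⇒m%n≡m (s≤s p<len))) ⟩
      lookupOr f L (toℕ p)               ∎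
      where open ≡-Reasoning
    ... | inj₂ p≡len = begin
      order (next p)                     ≡⟨ lookupOr-lookup f (f ∷ L) (next p) ⟨
      lookupOr f (f ∷ L) (toℕ (next p))  ≡⟨ cong (lookupOr f (f ∷ L)) (trans (toℕ-next n p) wraps) ⟩
      f                                  ≡⟨ lookupOr-length f L ⟨
      lookupOr f L (length L)            ≡⟨ cong (lookupOr f L) p≡len ⟨
      lookupOr f L (toℕ p)               ∎
      where
      open ≡-Reasoning
      wraps : suc (toℕ p) % suc (length L) ≡ 0
      wraps = trans (cong (λ z → suc z % suc (length L)) p≡len) (n%n≡0 (suc (length L)))

    order-distinct : Injective _≡_ _≡_ order
    order-distinct {Fin.zero}  {Fin.zero}  _  = refl
    order-distinct {Fin.zero}  {Fin.suc q} eq = ⊥-elim (irrefl ≈-refl (subst (λ z → rank (lookup L q) ≺ rank z) eq (rank-below-end P q)))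
    order-distinct {Fin.suc p} {Fin.zero}  eq = ⊥-elim (irrefl ≈-refl (subst (λ z → rank (lookup L p) ≺ rank z) (sym eq) (rank-below-end P p)))
    order-distinct {Fin.suc p} {Fin.suc q} eq = cong Fin.suc (vertices-distinct P eq)

    order-covers : ∀ u → ∃ λ p → order p ≡ u
    order-covers u with covers u
    ... | inj₁ refl = Fin.zero , refl
    ... | inj₂ u∈L  = map Fin.suc id (infix-position u∈L)

    order-arcs : ∀ p → Arc (order p) (order (next p))
    order-arcs Fin.zero    = subst (Arc f) (sym (trans (order-next Fin.zero) (lookupOr-start P))) f-s
    order-arcs (Fin.suc q) = subst (Arc (lookup L q)) (sym (order-next (Fin.suc q))) (path-arc P q)

    cycle : HamiltonianCycle
    cycle = record { len = length L ; seq = order ; distinct = order-distinct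
                   ; covering = order-covers ; arcs = order-arcs }

    onCycle : ∀ {u u′} → Infix (u ∷ u′ ∷ []) L → OnCycle cycle u u′
    onCycle uu′⊑L with infix-position₂ f uu′⊑L
    ... | p , at-p , after-p = Fin.suc p , at-p , trans (order-next (Fin.suc p)) after-p

  module FromValidGrid (g : Grid) (valid : ValidSudoku g) where

    colOf : Fin N → Fin N → Fin N
    colOf i k = proj₁ (proj₁ valid i k)

    g-colOf : ∀ i k → g i (colOf i k) ≡ k
    g-colOf i k = proj₁ (proj₂ (proj₁ valid i k))

    colOf-g : ∀ i j → colOf i (g i j) ≡ j
    colOf-g i j = sym (proj₂ (proj₂ (proj₁ valid i (g i j))) j refl)

    rowOf : Fin N → Fin N → Fin N
    rowOf j k = proj₁ (proj₁ (proj₂ valid) j k)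

    g-rowOf : ∀ j k → g (rowOf j k) j ≡ k
    g-rowOf j k = proj₁ (proj₂ (proj₁ (proj₂ valid) j k))

    rowOf-g : ∀ i j → rowOf j (g i j) ≡ i
    rowOf-g i j = sym (proj₂ (proj₂ (proj₁ (proj₂ valid) j (g i j))) i refl)

    cellIn : Fin N → Fin N → Fin N × Fin N
    cellIn a k = proj₁ (proj₂ (proj₂ valid) a k)

    block-cellIn : ∀ a k → block (proj₁ (cellIn a k)) (proj₂ (cellIn a k)) ≡ a
    block-cellIn a k = proj₁ (proj₁ (proj₂ (proj₂ (proj₂ valid) a k)))

    g-cellIn : ∀ a k → g (proj₁ (cellIn a k)) (proj₂ (cellIn a k)) ≡ k
    g-cellIn a k = proj₂ (proj₁ (proj₂ (proj₂ (proj₂ valid) a k)))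

    cellIn-g : ∀ i j → cellIn (block i j) (g i j) ≡ (i , j)
    cellIn-g i j = sym (proj₂ (proj₂ (proj₂ (proj₂ valid) (block i j) (g i j))) (i , j) (refl , refl))

    -- The cycle runs through three phases: blocks (rank 1), rows (rank 2), columns (rank 3).
    -- The gadget x i j k with k ≠ g i j is traversed forwards in the block phase of (block i j , g i j),
    -- at offset δ from g i j; the gadgets with k ≡ g i j are traversed backwards in the row (x) or
    -- column (y) phase.
    rank : Vertex → List ℕ
    rank s = 0 ∷ []
    rank (b a k) = 1 ∷ toℕ a ∷ toℕ k ∷ 0 ∷ []
    rank (x i j k l) with k Fin.≟ g i j
    ... | yes _ = 2 ∷ toℕ i ∷ toℕ k ∷ 1 ∷ (2 ∸ toℕ l) ∷ []
    ... | no _  = 1 ∷ toℕ (block i j) ∷ toℕ (g i j) ∷ 1 ∷ 0 ∷ offset (g i j) k ∷ toℕ l ∷ []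
    rank (y i j k l) with k Fin.≟ g i j
    ... | yes _ = 3 ∷ toℕ j ∷ toℕ k ∷ 1 ∷ (2 ∸ toℕ l) ∷ []
    ... | no _  = 1 ∷ toℕ (block i j) ∷ toℕ (g i j) ∷ 1 ∷ 1 ∷ offset (g i j) k ∷ toℕ l ∷ []
    rank (r i k) = 2 ∷ toℕ i ∷ toℕ k ∷ 0 ∷ []
    rank (v i j) = 2 ∷ toℕ i ∷ toℕ (g i j) ∷ 2 ∷ []
    rank (t i)   = 2 ∷ toℕ i ∷ N ∷ []
    rank (c j k) = 3 ∷ toℕ j ∷ toℕ k ∷ 0 ∷ []
    rank (w i j) = 3 ∷ toℕ j ∷ toℕ (g i j) ∷ 2 ∷ []
    rank (d j)   = 3 ∷ toℕ j ∷ N ∷ []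
    rank f = 4 ∷ []

    rank-x-closed : ∀ {i j k} l → k ≡ g i j → rank (x i j k l) ≡ 2 ∷ toℕ i ∷ toℕ k ∷ 1 ∷ (2 ∸ toℕ l) ∷ []
    rank-x-closed {i} {j} {k} l k≡g with k Fin.≟ g i j
    ... | yes _   = refl
    ... | no k≢g = ⊥-elim (k≢g k≡g)

    rank-y-closed : ∀ {i j k} l → k ≡ g i j → rank (y i j k l) ≡ 3 ∷ toℕ j ∷ toℕ k ∷ 1 ∷ (2 ∸ toℕ l) ∷ []
    rank-y-closed {i} {j} {k} l k≡g with k Fin.≟ g i j
    ... | yes _   = refl
    ... | no k≢g = ⊥-elim (k≢g k≡g)

    module _ (a K : Fin N) {δ} (0<δ : 0 < δ) (δ<N : δ < N) (l : Fin 3) where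
      private
        i₀ j₀ : Fin N
        i₀ = proj₁ (cellIn a K)
        j₀ = proj₂ (cellIn a K)
        off≡δ : offset (g i₀ j₀) (K ⊕ δ) ≡ δ
        off≡δ = trans (cong (λ z → offset z (K ⊕ δ)) (g-cellIn a K)) (offset-⊕ K δ<N)
        open-prefix : ∀ layer → 1 ∷ toℕ (block i₀ j₀) ∷ toℕ (g i₀ j₀) ∷ 1 ∷ layer ∷ offset (g i₀ j₀) (K ⊕ δ) ∷ toℕ l ∷ []
                                ≡ 1 ∷ toℕ a ∷ toℕ K ∷ 1 ∷ layer ∷ δ ∷ toℕ l ∷ []
        open-prefix layer = entries (cong toℕ (block-cellIn a K)) (cong toℕ (g-cellIn a K)) off≡δ
          where
          entries : ∀ {p p′ q q′ o o′} → p ≡ p′ → q ≡ q′ → o ≡ o′ →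
                    1 ∷ p ∷ q ∷ 1 ∷ layer ∷ o ∷ toℕ l ∷ [] ≡ 1 ∷ p′ ∷ q′ ∷ 1 ∷ layer ∷ o′ ∷ toℕ l ∷ []
          entries refl refl refl = refl
        K⊕δ≢g : K ⊕ δ ≢ g i₀ j₀
        K⊕δ≢g eq = ⊕-≢ K 0<δ δ<N (trans eq (g-cellIn a K))

      rank-x-open : rank (x i₀ j₀ (K ⊕ δ) l) ≡ 1 ∷ toℕ a ∷ toℕ K ∷ 1 ∷ 0 ∷ δ ∷ toℕ l ∷ []
      rank-x-open with (K ⊕ δ) Fin.≟ g i₀ j₀
      ... | yes eq = ⊥-elim (K⊕δ≢g eq)
      ... | no _   = open-prefix 0

      rank-y-open : rank (y i₀ j₀ (K ⊕ δ) l) ≡ 1 ∷ toℕ a ∷ toℕ K ∷ 1 ∷ 1 ∷ δ ∷ toℕ l ∷ []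
      rank-y-open with (K ⊕ δ) Fin.≟ g i₀ j₀
      ... | yes eq = ⊥-elim (K⊕δ≢g eq)
      ... | no _   = open-prefix 1

    open RankedPaths Arc lexicographic rank

    step : ∀ {u u′ R R′} → Arc u u′ → rank u ≡ R → rank u′ ≡ R′ → R ≺ R′ → Step u u′
    step arc refl refl R≺R′ = arc , R≺R′

    listing : (Fin N → Vertex) → Vertex → ℕ → Vertex
    listing P E k with k <? N
    ... | yes k<N = P (fromℕ< k<N)
    ... | no _    = E

    listing-< : ∀ {P E k} .(k<N : k < N) → listing P E k ≡ P (fromℕ< k<N)
    listing-< {k = k} k<N with k <? N
    ... | yes _   = refl
    ... | no k≮N = ⊥-elim (k≮N (recompute (k <? N) k<N))

    listing-N : ∀ {P E} → listing P E N ≡ E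
    listing-N with N <? N
    ... | yes N<N = ⊥-elim (<-irrefl refl N<N)
    ... | no _    = refl

    step-listing : ∀ {u P E} K → (∀ K′ → toℕ K′ ≡ suc (toℕ K) → Step u (P K′)) → (suc (toℕ K) ≡ N → Step u E) →
                   Step u (listing P E (suc (toℕ K)))
    step-listing K toNext toEnd with suc (toℕ K) <? N
    ... | yes 1+K<N = toNext (fromℕ< 1+K<N) (toℕ-fromℕ< 1+K<N)
    ... | no 1+K≮N  = toEnd (≤-antisym (toℕ<n K) (≮⇒≥ 1+K≮N))

    listingℕ : (ℕ → Vertex) → Vertex → ℕ → Vertex
    listingℕ P E k with k <? N
    ... | yes _ = P k
    ... | no _  = E

    listingℕ-< : ∀ {P E k} .(k<N : k < N) → listingℕ P E k ≡ P k
    listingℕ-< {k = k} k<N with k <? N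
    ... | yes _   = refl
    ... | no k≮N = ⊥-elim (k≮N (recompute (k <? N) k<N))

    listingℕ-N : ∀ {P E} → listingℕ P E N ≡ E
    listingℕ-N with N <? N
    ... | yes N<N = ⊥-elim (<-irrefl refl N<N)
    ... | no _    = refl

    step-listingℕ : ∀ {u P E δ} → δ < N → (suc δ < N → Step u (P (suc δ))) → (suc δ ≡ N → Step u E) →
                    Step u (listingℕ P E (suc δ))
    step-listingℕ {δ = δ} δ<N toNext toEnd with suc δ <? N
    ... | yes 1+δ<N = toNext 1+δ<N
    ... | no 1+δ≮N  = toEnd (≤-antisym δ<N (≮⇒≥ 1+δ≮N))

    module _ (P : Fin N → Vertex) (E : Vertex) (piece : ∀ K → Path (P K) (listing P E (suc (toℕ K)))) where
      private
        piece′ : ∀ k → .(k < N) → Path (listing P E k) (listing P E (suc k))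
        piece′ k k<N = subst₂ Path (sym (listing-< k<N)) (cong (λ z → listing P E (suc z)) (toℕ-fromℕ< k<N))
                                   (piece (fromℕ< k<N))

      concatFin : Path (P 𝟎) E
      concatFin = subst₂ Path starts listing-N (concat (listing P E) N piece′)
        where
        starts : listing P E 0 ≡ P 𝟎
        starts = trans (listing-< (≤-trans (s≤s z≤n) N≥2)) (cong P (toℕ-injective (trans (toℕ-fromℕ< _) (sym toℕ-𝟎))))

      infix-concatFin : ∀ {M} K → Infix M (vertices (piece K)) → Infix M (vertices concatFin)
      infix-concatFin {M} K M⊑piece = infix-subst₂ _ _ _ (infix-concat (listing P E) N piece′ (toℕ K) (toℕ<n K)
        (infix-subst₂ _ _ _ (subst (λ z → Infix M (vertices (piece z))) (sym (fromℕ<-toℕ K (toℕ<n K))) M⊑piece)))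

    module _ (P : ℕ → Vertex) (E : Vertex) (piece : ∀ δ → 0 < δ → δ < N → Path (P δ) (listingℕ P E (suc δ))) where
      private
        1+k<N : ∀ {k} → k < N ∸ 1 → suc k < N
        1+k<N {k} k<N-1 = subst (suc (suc k) ≤_) (m+[n∸m]≡n (<⇒≤ N≥2)) (s≤s k<N-1)

        piece′ : ∀ k → .(k < N ∸ 1) → Path (listingℕ P E (suc k)) (listingℕ P E (suc (suc k)))
        piece′ k k<N-1 = subst₂ Path (sym (listingℕ-< (1+k<N k<N-1))) refl
                                     (piece (suc k) (s≤s z≤n) (recompute (suc k <? N) (1+k<N k<N-1)))

      run : Path (P 1) E
      run = subst₂ Path (listingℕ-< N≥2) (trans (cong (listingℕ P E) (m+[n∸m]≡n (<⇒≤ N≥2))) listingℕ-N)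
                        (concat (λ k → listingℕ P E (suc k)) (N ∸ 1) piece′)

      infix-run : ∀ {M} k (1+k<N : suc k < N) → Infix M (vertices (piece (suc k) (s≤s z≤n) 1+k<N)) → Infix M (vertices run)
      infix-run {M} k 1+k<N M⊑piece = infix-subst₂ _ _ _ (infix-concat _ (N ∸ 1) piece′ k (∸-monoˡ-≤ 1 1+k<N)
        (infix-subst₂ _ _ _ (subst (λ p → Infix M (vertices (piece (suc k) (s≤s z≤n) p))) (<-irrelevant _ _) M⊑piece)))

    nextBlock : Fin N → Vertex
    nextBlock a = listing (λ a′ → b a′ 𝟎) (r 𝟎 𝟎) (suc (toℕ a))

    afterDigit : Fin N → Fin N → Vertex
    afterDigit a K = listing (b a) (nextBlock a) (suc (toℕ K))

    module BlockPiece (a K : Fin N) where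
      i₀ j₀ : Fin N
      i₀ = proj₁ (cellIn a K)
      j₀ = proj₂ (cellIn a K)

      xRun yRun : ℕ → Vertex
      xRun = listingℕ (λ δ → x i₀ j₀ (K ⊕ δ) L1) (y i₀ j₀ (K ⊕ 1) L1)
      yRun = listingℕ (λ δ → y i₀ j₀ (K ⊕ δ) L1) (afterDigit a K)

      ⊕-suc : ∀ δ → (K ⊕ δ) ⊕ 1 ≡ K ⊕ suc δ
      ⊕-suc δ = trans (⊕-+ K δ 1) (cong (K ⊕_) (+-comm δ 1))

      ⊕-wrap : ∀ {δ} → suc δ ≡ N → (K ⊕ δ) ⊕ 2 ≡ K ⊕ 1
      ⊕-wrap {δ} 1+δ≡N = trans (⊕-+ K δ 2) (trans (cong (K ⊕_) (trans (+-suc δ 1) (cong (_+ 1) 1+δ≡N))) (⊕-N+ K 1))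

      x-gadget : ∀ δ → 0 < δ → δ < N → Path (x i₀ j₀ (K ⊕ δ) L1) (xRun (suc δ))
      x-gadget δ 0<δ δ<N =
          step (x12 i₀ j₀ (K ⊕ δ)) (rx L1) (rx L2) (same (same (same (same (same (same (this (s≤s z≤n))))))))
        ∷ step (x23 i₀ j₀ (K ⊕ δ)) (rx L2) (rx L3) (same (same (same (same (same (same (this (s≤s (s≤s z≤n)))))))))
        ∷ step-listingℕ δ<N
            (λ 1+δ<N → step (subst (λ z → Arc (x i₀ j₀ (K ⊕ δ) L3) (x i₀ j₀ z L1)) (⊕-suc δ) (x-x i₀ j₀ (K ⊕ δ))) (rx L3)
                            (rank-x-open a K (s≤s z≤n) 1+δ<N L1) (same (same (same (same (same (this (n<1+n δ))))))))
            (λ 1+δ≡N → step (subst (λ z → Arc (x i₀ j₀ (K ⊕ δ) L3) (y i₀ j₀ z L1)) (⊕-wrap 1+δ≡N) (x-y i₀ j₀ (K ⊕ δ))) (rx L3)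
                            (rank-y-open a K (s≤s z≤n) N≥2 L1) (same (same (same (same (this (s≤s z≤n)))))))
        ∷ []
        where
        rx : ∀ l → rank (x i₀ j₀ (K ⊕ δ) l) ≡ 1 ∷ toℕ a ∷ toℕ K ∷ 1 ∷ 0 ∷ δ ∷ toℕ l ∷ []
        rx = rank-x-open a K 0<δ δ<N

      y-exit : ∀ {δ} → 0 < δ → δ < N → suc δ ≡ N → Step (y i₀ j₀ (K ⊕ δ) L3) (afterDigit a K)
      y-exit {δ} 0<δ δ<N 1+δ≡N = step-listing K
          (λ K′ toℕK′ → step (subst (Arc (y i₀ j₀ (K ⊕ δ) L3)) (cong₂ b (block-cellIn a K) (trans (⊕-wrap 1+δ≡N) (⊕1-toℕ toℕK′)))
                                       (y-b i₀ j₀ (K ⊕ δ) (no-wrap toℕK′)))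
                             ry (cong (λ z → 1 ∷ toℕ a ∷ z ∷ 0 ∷ []) toℕK′) (same (same (this (n<1+n (toℕ K))))))
          (λ 1+K≡N → step-listing a
            (λ a′ toℕa′ → step (y-b' i₀ j₀ (K ⊕ δ) a′ (wraps 1+K≡N) (trans toℕa′ (cong (suc ∘ toℕ) (sym (block-cellIn a K)))))
                               ry (cong (λ z → 1 ∷ z ∷ toℕ 𝟎 ∷ 0 ∷ []) toℕa′) (same (this (n<1+n (toℕ a)))))
            (λ 1+a≡N → step (y-r i₀ j₀ (K ⊕ δ) (wraps 1+K≡N) (trans (cong (suc ∘ toℕ) (block-cellIn a K)) 1+a≡N))
                            ry refl (this (s≤s (s≤s z≤n)))))
        where
        ry : rank (y i₀ j₀ (K ⊕ δ) L3) ≡ 1 ∷ toℕ a ∷ toℕ K ∷ 1 ∷ 1 ∷ δ ∷ 2 ∷ []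
        ry = rank-y-open a K 0<δ δ<N L3
        toℕ-K⊕1 : toℕ ((K ⊕ δ) ⊕ 2) ≡ toℕ (K ⊕ 1)
        toℕ-K⊕1 = cong toℕ (⊕-wrap 1+δ≡N)
        no-wrap : ∀ {K′} → toℕ K′ ≡ suc (toℕ K) → toℕ (K ⊕ δ) + 2 ≢ N
        no-wrap {K′} toℕK′ eq with trans (sym (toℕ-⊕2≡0 _ eq)) (trans toℕ-K⊕1 (trans (cong toℕ (⊕1-toℕ toℕK′)) toℕK′))
        ... | ()
        wraps : suc (toℕ K) ≡ N → toℕ (K ⊕ δ) + 2 ≡ N
        wraps 1+K≡N = toℕ+2≡N _ (trans toℕ-K⊕1 (toℕ-⊕1≡0 K 1+K≡N))

      y-gadget : ∀ δ → 0 < δ → δ < N → Path (y i₀ j₀ (K ⊕ δ) L1) (yRun (suc δ))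
      y-gadget δ 0<δ δ<N =
          step (y12 i₀ j₀ (K ⊕ δ)) (ry L1) (ry L2) (same (same (same (same (same (same (this (s≤s z≤n))))))))
        ∷ step (y23 i₀ j₀ (K ⊕ δ)) (ry L2) (ry L3) (same (same (same (same (same (same (this (s≤s (s≤s z≤n)))))))))
        ∷ step-listingℕ δ<N
            (λ 1+δ<N → step (subst (λ z → Arc (y i₀ j₀ (K ⊕ δ) L3) (y i₀ j₀ z L1)) (⊕-suc δ) (y-y i₀ j₀ (K ⊕ δ))) (ry L3)
                            (rank-y-open a K (s≤s z≤n) 1+δ<N L1) (same (same (same (same (same (this (n<1+n δ))))))))
            (y-exit 0<δ δ<N)
        ∷ []
        where
        ry : ∀ l → rank (y i₀ j₀ (K ⊕ δ) l) ≡ 1 ∷ toℕ a ∷ toℕ K ∷ 1 ∷ 1 ∷ δ ∷ toℕ l ∷ []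
        ry = rank-y-open a K 0<δ δ<N

      piece : Path (b a K) (afterDigit a K)
      piece = step (b-x a K i₀ j₀ (block-cellIn a K)) refl (rank-x-open a K (s≤s z≤n) N≥2 L1) (same (same (same (this (s≤s z≤n)))))
            ∷ (run (λ δ → x i₀ j₀ (K ⊕ δ) L1) (y i₀ j₀ (K ⊕ 1) L1) x-gadget
               ++ₚ run (λ δ → y i₀ j₀ (K ⊕ δ) L1) (afterDigit a K) y-gadget)

    blockPath : ∀ a → Path (b a 𝟎) (nextBlock a)
    blockPath a = concatFin (b a) (nextBlock a) (BlockPiece.piece a)

    blockPhase : Path (b 𝟎 𝟎) (r 𝟎 𝟎)
    blockPhase = concatFin (λ a → b a 𝟎) (r 𝟎 𝟎) blockPath

    module RowPiece (i K : Fin N) where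
      j₀ : Fin N
      j₀ = colOf i K

      rx : ∀ l → rank (x i j₀ K l) ≡ 2 ∷ toℕ i ∷ toℕ K ∷ 1 ∷ (2 ∸ toℕ l) ∷ []
      rx l = rank-x-closed l (sym (g-colOf i K))

      rv : rank (v i j₀) ≡ 2 ∷ toℕ i ∷ toℕ K ∷ 2 ∷ []
      rv = cong (λ z → 2 ∷ toℕ i ∷ toℕ z ∷ 2 ∷ []) (g-colOf i K)

      piece : Path (r i K) (listing (r i) (t i) (suc (toℕ K)))
      piece = step (r-x i j₀ K) refl (rx L3) (same (same (same (this (s≤s z≤n)))))
            ∷ step (x32 i j₀ K) (rx L3) (rx L2) (same (same (same (same (this (s≤s z≤n))))))
            ∷ step (x21 i j₀ K) (rx L2) (rx L1) (same (same (same (same (this (s≤s (s≤s z≤n)))))))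
            ∷ step (x-v i j₀ K) (rx L1) rv (same (same (same (this (s≤s (s≤s z≤n))))))
            ∷ step-listing K
                (λ K′ toℕK′ → step (v-r i j₀ K′) rv (cong (λ z → 2 ∷ toℕ i ∷ z ∷ 0 ∷ []) toℕK′) (same (same (this (n<1+n (toℕ K))))))
                (λ _ → step (v-t i j₀) rv refl (same (same (this (toℕ<n K)))))
            ∷ []

    rowPath : ∀ i → Path (r i 𝟎) (t i)
    rowPath i = concatFin (r i) (t i) (RowPiece.piece i)

    t-step : ∀ i → Step (t i) (listing (λ i′ → r i′ 𝟎) (c 𝟎 𝟎) (suc (toℕ i)))
    t-step i = step-listing i
      (λ i′ toℕi′ → step (t-r i i′ toℕi′) refl (cong (λ z → 2 ∷ z ∷ toℕ 𝟎 ∷ 0 ∷ []) toℕi′) (same (this (n<1+n (toℕ i)))))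
      (λ 1+i≡N → step (t-c i 1+i≡N) refl refl (this (s≤s (s≤s (s≤s z≤n)))))

    rowPhase : Path (r 𝟎 𝟎) (c 𝟎 𝟎)
    rowPhase = concatFin (λ i → r i 𝟎) (c 𝟎 𝟎) (λ i → rowPath i ++ₚ t-step i ∷ [])

    module ColumnPiece (j K : Fin N) where
      i₀ : Fin N
      i₀ = rowOf j K

      ry : ∀ l → rank (y i₀ j K l) ≡ 3 ∷ toℕ j ∷ toℕ K ∷ 1 ∷ (2 ∸ toℕ l) ∷ []
      ry l = rank-y-closed l (sym (g-rowOf j K))

      rw : rank (w i₀ j) ≡ 3 ∷ toℕ j ∷ toℕ K ∷ 2 ∷ []
      rw = cong (λ z → 3 ∷ toℕ j ∷ toℕ z ∷ 2 ∷ []) (g-rowOf j K)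

      piece : Path (c j K) (listing (c j) (d j) (suc (toℕ K)))
      piece = step (c-y i₀ j K) refl (ry L3) (same (same (same (this (s≤s z≤n)))))
            ∷ step (y32 i₀ j K) (ry L3) (ry L2) (same (same (same (same (this (s≤s z≤n))))))
            ∷ step (y21 i₀ j K) (ry L2) (ry L1) (same (same (same (same (this (s≤s (s≤s z≤n)))))))
            ∷ step (y-w i₀ j K) (ry L1) rw (same (same (same (this (s≤s (s≤s z≤n))))))
            ∷ step-listing K
                (λ K′ toℕK′ → step (w-c i₀ j K′) rw (cong (λ z → 3 ∷ toℕ j ∷ z ∷ 0 ∷ []) toℕK′) (same (same (this (n<1+n (toℕ K))))))
                (λ _ → step (w-d i₀ j) rw refl (same (same (this (toℕ<n K)))))
            ∷ []

    columnPath : ∀ j → Path (c j 𝟎) (d j)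
    columnPath j = concatFin (c j) (d j) (ColumnPiece.piece j)

    d-step : ∀ j → Step (d j) (listing (λ j′ → c j′ 𝟎) f (suc (toℕ j)))
    d-step j = step-listing j
      (λ j′ toℕj′ → step (d-c j j′ toℕj′) refl (cong (λ z → 3 ∷ z ∷ toℕ 𝟎 ∷ 0 ∷ []) toℕj′) (same (this (n<1+n (toℕ j)))))
      (λ 1+j≡N → step (d-f j 1+j≡N) refl refl (this (s≤s (s≤s (s≤s (s≤s z≤n))))))

    columnPhase : Path (c 𝟎 𝟎) f
    columnPhase = concatFin (λ j → c j 𝟎) f (λ j → columnPath j ++ₚ d-step j ∷ [])

    tour : Path s f
    tour = step s-b refl refl (this (s≤s z≤n)) ∷ blockPhase ++ₚ rowPhase ++ₚ columnPhase

    in-tour-blocks : ∀ {M} → Infix M (vertices blockPhase) → Infix M (vertices tour)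
    in-tour-blocks M⊑ = infix-∷ s _ (infix-++ₚˡ blockPhase _ M⊑)

    in-tour-rows : ∀ {M} → Infix M (vertices rowPhase) → Infix M (vertices tour)
    in-tour-rows M⊑ = infix-∷ s _ (infix-++ₚʳ blockPhase _ (infix-++ₚˡ rowPhase columnPhase M⊑))

    in-tour-columns : ∀ {M} → Infix M (vertices columnPhase) → Infix M (vertices tour)
    in-tour-columns M⊑ = infix-∷ s _ (infix-++ₚʳ blockPhase _ (infix-++ₚʳ rowPhase columnPhase M⊑))

    in-tour-blockPiece : ∀ a K {M} → Infix M (vertices (BlockPiece.piece a K)) → Infix M (vertices tour)
    in-tour-blockPiece a K M⊑ = in-tour-blocks (infix-concatFin (λ a → b a 𝟎) (r 𝟎 𝟎) blockPath a
                                  (infix-concatFin (b a) (nextBlock a) (BlockPiece.piece a) K M⊑))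

    in-tour-row : ∀ i {M} → Infix M (vertices (rowPath i ++ₚ t-step i ∷ [])) → Infix M (vertices tour)
    in-tour-row i M⊑ = in-tour-rows (infix-concatFin (λ i → r i 𝟎) (c 𝟎 𝟎) _ i M⊑)

    in-tour-rowPiece : ∀ i K {M} → Infix M (vertices (RowPiece.piece i K)) → Infix M (vertices tour)
    in-tour-rowPiece i K M⊑ = in-tour-row i (infix-++ₚˡ (rowPath i) _ (infix-concatFin (r i) (t i) (RowPiece.piece i) K M⊑))

    in-tour-column : ∀ j {M} → Infix M (vertices (columnPath j ++ₚ d-step j ∷ [])) → Infix M (vertices tour)
    in-tour-column j M⊑ = in-tour-columns (infix-concatFin (λ j → c j 𝟎) f _ j M⊑)

    in-tour-columnPiece : ∀ j K {M} → Infix M (vertices (ColumnPiece.piece j K)) → Infix M (vertices tour)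
    in-tour-columnPiece j K M⊑ = in-tour-column j (infix-++ₚˡ (columnPath j) _ (infix-concatFin (c j) (d j) (ColumnPiece.piece j) K M⊑))

    in-forward : ∀ (P : Fin 3 → Vertex) l → Infix (P l ∷ []) (P L1 ∷ P L2 ∷ P L3 ∷ [])
    in-forward P Fin.zero                   = [] , _ , refl
    in-forward P (Fin.suc Fin.zero)           = P L1 ∷ [] , _ , refl
    in-forward P (Fin.suc (Fin.suc Fin.zero)) = P L1 ∷ P L2 ∷ [] , _ , refl

    in-backward : ∀ (P : Fin 3 → Vertex) l → Infix (P l ∷ []) (P L3 ∷ P L2 ∷ P L1 ∷ [])
    in-backward P Fin.zero                   = P L3 ∷ P L2 ∷ [] , _ , refl
    in-backward P (Fin.suc Fin.zero)           = P L3 ∷ [] , _ , refl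
    in-backward P (Fin.suc (Fin.suc Fin.zero)) = [] , _ , refl

    in-x-run : ∀ a K k l (1+k<N : suc k < N) →
               Infix (x (proj₁ (cellIn a K)) (proj₂ (cellIn a K)) (K ⊕ suc k) l ∷ []) (vertices tour)
    in-x-run a K k l 1+k<N = in-tour-blockPiece a K (infix-∷ (b a K) _ (infix-++ₚˡ (run _ _ x-gadget) (run _ _ y-gadget)
                               (infix-run _ _ x-gadget k 1+k<N (in-forward (x i₀ j₀ (K ⊕ suc k)) l))))
      where open BlockPiece a K

    in-y-run : ∀ a K k l (1+k<N : suc k < N) →
               Infix (y (proj₁ (cellIn a K)) (proj₂ (cellIn a K)) (K ⊕ suc k) l ∷ []) (vertices tour)
    in-y-run a K k l 1+k<N = in-tour-blockPiece a K (infix-∷ (b a K) _ (infix-++ₚʳ (run _ _ x-gadget) (run _ _ y-gadget)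
                               (infix-run _ _ y-gadget k 1+k<N (in-forward (y i₀ j₀ (K ⊕ suc k)) l))))
      where open BlockPiece a K

    at-cell : ∀ {ij i j K m} (V : Fin N → Fin N → Fin N → Vertex) → ij ≡ (i , j) → K ≡ m →
              Infix (V (proj₁ ij) (proj₂ ij) K ∷ []) (vertices tour) → Infix (V i j m ∷ []) (vertices tour)
    at-cell V refl refl V⊑ = V⊑

    covers : ∀ u → u ≡ f ⊎ Infix (u ∷ []) (vertices tour)
    covers s       = inj₂ ([] , _ , refl)
    covers f       = inj₁ refl
    covers (b a K) = inj₂ (in-tour-blockPiece a K ([] , _ , refl))
    covers (r i K) = inj₂ (in-tour-rowPiece i K ([] , _ , refl))
    covers (t i)   = inj₂ (in-tour-row i (infix-++ₚʳ (rowPath i) _ (infix-refl _)))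
    covers (c j K) = inj₂ (in-tour-columnPiece j K ([] , _ , refl))
    covers (d j)   = inj₂ (in-tour-column j (infix-++ₚʳ (columnPath j) _ (infix-refl _)))
    covers (v i j) = inj₂ (subst (λ z → Infix (v i z ∷ []) (vertices tour)) (colOf-g i j)
                             (in-tour-rowPiece i (g i j) (_ ∷ _ ∷ _ ∷ _ ∷ [] , [] , refl)))
    covers (w i j) = inj₂ (subst (λ z → Infix (w z j ∷ []) (vertices tour)) (rowOf-g i j)
                             (in-tour-columnPiece j (g i j) (_ ∷ _ ∷ _ ∷ _ ∷ [] , [] , refl)))
    covers (x i j m l) with m Fin.≟ g i j
    ... | yes refl = inj₂ (subst (λ z → Infix (x i z (g i j) l ∷ []) (vertices tour)) (colOf-g i j)
                             (in-tour-rowPiece i (g i j) (infix-trans (in-backward (x i (colOf i (g i j)) (g i j)) l) (_ ∷ [] , _ , refl))))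
    ... | no m≢g with ⊕-offset-suc (g i j) m m≢g
    ...   | k , 1+k<N , g⊕δ≡m = inj₂ (at-cell (λ i j m → x i j m l) (cellIn-g i j) g⊕δ≡m (in-x-run (block i j) (g i j) k l 1+k<N))
    covers (y i j m l) with m Fin.≟ g i j
    ... | yes refl = inj₂ (subst (λ z → Infix (y z j (g i j) l ∷ []) (vertices tour)) (rowOf-g i j)
                             (in-tour-columnPiece j (g i j) (infix-trans (in-backward (y (rowOf j (g i j)) j (g i j)) l) (_ ∷ [] , _ , refl))))
    ... | no m≢g with ⊕-offset-suc (g i j) m m≢g
    ...   | k , 1+k<N , g⊕δ≡m = inj₂ (at-cell (λ i j m → y i j m l) (cellIn-g i j) g⊕δ≡m (in-y-run (block i j) (g i j) k l 1+k<N))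

    open ClosingPath rank tour covers public using (cycle; onCycle)

    reads-g : ReadsOff cycle g
    reads-g i j = x→v , λ k x₁→v → proj₂ (proj₂ (x-injective (succ-injective (trans (onCycle⇒succ x₁→v) (sym (onCycle⇒succ x→v))))))
      where
      open FromHamiltonianCycle cycle using (succ-injective; onCycle⇒succ)
      x→v : OnCycle cycle (x i j (g i j) L1) (v i j)
      x→v = onCycle (subst (λ z → Infix (x i z (g i j) L1 ∷ v i z ∷ []) (vertices tour)) (colOf-g i j)
                             (in-tour-rowPiece i (g i j) (_ ∷ _ ∷ _ ∷ [] , [] , refl)))

  grid-of-cycle : (H : HamiltonianCycle) → Σ Grid λ g → ReadsOff H g × ValidSudoku g
  grid-of-cycle H = grid , reads-grid , grid-valid
    where open FromHamiltonianCycle H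

  cycle-of-grid : (g : Grid) → ValidSudoku g → Σ HamiltonianCycle λ H → ReadsOff H g
  cycle-of-grid g valid = cycle , reads-g
    where open FromValidGrid g valid

theorem1 : (n : ℕ) .{{_ : NonZero n}} → 2 ≤ n →
    let open Sudoku n in
      ((H : HamiltonianCycle) → Σ Grid λ g → ReadsOff H g × ValidSudoku g)
    × ((g : Grid) → ValidSudoku g → Σ HamiltonianCycle λ H → ReadsOff H g)
    × HamiltonianCycle
theorem1 n n≥2 = grid-of-cycle n n≥2
               , cycle-of-grid n n≥2
               , proj₁ (cycle-of-grid n n≥2 (patternGrid n) (patternGrid-valid n))
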